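{- Let $n\ge 2$, $l_1,\dots,l_n,l_\infty\ge 0$. For an arc diagram $x\in X(l_1,\dots,l_n,l_\infty)$, let $G(x)$ be the greatest common divisor of the numbers $N_{a,b}(x)$, where $N_{a,b}(x)$ is the number of arcs of $x$ joining the marked points $z_a$ and $z_b$, over all pairs $a\ne b$ in $\{1,\dots,n,\infty\}$. Then $G(gx)=G(x)$ for every $g\in J_n$.
   Context: An arc diagram of type $(l_1,\dots,l_n,l_\infty)$ consists of a circle (the boundary of a closed disc) carrying $n+1$ distinct marked points labelled $z_\infty,z_1,\dots,z_n$ (the labels $z_1,\dots,z_n$ may appear in any order), together with finitely many arcs inside the disc, pairwise non-intersecting except at endpoints, each joining two distinct marked points (several arcs may join the same pair), such that $z_k$ is an endpoint of exactly $l_k$ arcs. Diagrams are considered up to continuous deformation; $X(l_1,\dots,l_n,l_\infty)$ is the set of all of them. Going clockwise from $z_\infty$, the other marked points occupy positions $1,\dots,n$. The cactus group $J_n$ has generators $s_{p,q}$ ($1\le p<q\le n$) and relations $s_{p,q}^2=e$; $s_{p,q}s_{p',q'}=s_{p',q'}s_{p,q}$ if $[p,q]\cap[p',q']=\emptyset$; $s_{p,q}s_{p',q'}s_{p,q}=s_{p+q-q',p+q-p'}$ if $p\le p'<q'\le q$. It acts on $X(l_1,\dots,l_n,l_\infty)$ as follows: for $s_{p,q}$, take a chord $c$ separating the points in positions $p,\dots,q$ from the other marked points (arcs deformed to cross $c$ at most once), reflect the part of the diagram on the side of $c$ not containing $z_\infty$ across the perpendicular bisector of $c$ (reversing the order of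 the points in positions $p,\dots,q$ and of the crossing points on $c$), and rejoin the arc pieces across $c$. Products act right to left. -}

module Defs where

open import Data.Nat using (ℕ; zero; suc; _+_; _∸_; _≤_; _<_; _≤ᵇ_; _<ᵇ_; _≡ᵇ_; _⊔_; _⊓_)
open import Data.Nat.GCD using (gcd)
open import Data.Nat.ListAction using (sum)
open import Data.Bool using (Bool; true; false; if_then_else_; _∧_; _∨_; not)
open import Data.List using (List; []; _∷_; map; foldr; reverse; zip; _++_; filterᵇ; upTo; concatMap)
open import Data.Product using (_×_; _,_; proj₁; proj₂; Σ)
open import Data.Sum using (_⊎_)
open import Data.Fin using (Fin; toℕ)
open import Relation.Binary.PropositionalEquality using (_≡_; _≢_)
open import Relation.Nullary using (¬_)
open import Data.List.Membership.Propositional using (_∈_)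

-- Positions on the circle are natural numbers 0..n: position 0 is the
-- marked point z_∞, positions 1..n are the other marked points, read
-- clockwise from z_∞.  Labels are natural numbers 0..n: label 0 is ∞,
-- label k (1 ≤ k ≤ n) is z_k.  An arc is an (unordered) pair of
-- positions; a diagram up to deformation is determined by the labelling
-- of positions and the multiset (here: a list) of arcs.

Arc : Set
Arc = ℕ × ℕ

record Diagram : Set where
  constructor diagram
  field
    lab  : ℕ → ℕ
    arcs : List Arc

open Diagram public

Cross : Arc → Arc → Set
Cross (a , b) (c , d) =
  let a' = a ⊓ b ; b' = a ⊔ b ; c' = c ⊓ d ; d' = c ⊔ d in
  (a' < c' × c' < b' × b' < d') ⊎ (c' < a' × a' < d' × d' < b')

ind : Bool → ℕ
ind true  = 1
ind false = 0

degree : Diagram → ℕ → ℕ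
degree x k = sum (map (λ e → ind (lab x (proj₁ e) ≡ᵇ k) + ind (lab x (proj₂ e) ≡ᵇ k)) (arcs x))

-- x is an arc diagram of type (l_1,…,l_n,l_∞); l zero = l_∞, l (suc i) = l_{i+1}
record IsArcDiagram (n : ℕ) (l : Fin (suc n) → ℕ) (x : Diagram) : Set where
  field
    lab-∞      : lab x 0 ≡ 0
    lab-range  : ∀ i → 1 ≤ i → i ≤ n → (1 ≤ lab x i × lab x i ≤ n)
    lab-inj    : ∀ i j → i ≤ n → j ≤ n → lab x i ≡ lab x j → i ≡ j
    arc-range  : ∀ {a b} → (a , b) ∈ arcs x → a ≤ n × b ≤ n
    arc-proper : ∀ {a b} → (a , b) ∈ arcs x → a ≢ b
    noncross   : ∀ {e f} → e ∈ arcs x → f ∈ arcs x → ¬ Cross e f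
    degrees    : ∀ (k : Fin (suc n)) → degree x (toℕ k) ≡ l k

N : Diagram → ℕ → ℕ → ℕ
N x a b = sum (map (λ e → ind (((lab x (proj₁ e) ≡ᵇ a) ∧ (lab x (proj₂ e) ≡ᵇ b))
                               ∨ ((lab x (proj₁ e) ≡ᵇ b) ∧ (lab x (proj₂ e) ≡ᵇ a)))) (arcs x))

-- G(x): gcd of N_{a,b}(x) over all pairs of distinct labels a < b in {0..n}
-- (N is symmetric, so this is the gcd over all a ≠ b)
G : ℕ → Diagram → ℕ
G n x = foldr gcd 0
  (concatMap (λ a → map (λ b → N x a b) (filterᵇ (λ b → a <ᵇ b) (upTo (suc n)))) (upTo (suc n)))

-- Cactus group: generators s_{p,q}, 1 ≤ p < q ≤ n; elements of J_n are
-- represented by words in the generators.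

Gen : ℕ → Set
Gen n = Σ ℕ λ p → Σ ℕ λ q → (1 ≤ p × p < q × q ≤ n)

Word : ℕ → Set
Word n = List (Gen n)

insertBy : (ℕ → ℕ) → ℕ → List ℕ → List ℕ
insertBy key v []       = v ∷ []
insertBy key v (w ∷ ws) = if key v ≤ᵇ key w then v ∷ w ∷ ws else w ∷ insertBy key v ws

sortBy : (ℕ → ℕ) → List ℕ → List ℕ
sortBy key = foldr (insertBy key) []

module _ (n p q : ℕ) where
  inside : ℕ → Bool
  inside i = (p ≤ᵇ i) ∧ (i ≤ᵇ q)

  refl-pos : ℕ → ℕ
  refl-pos i = if inside i then p + q ∸ i else i

  -- clockwise order of the outside positions q+1,…,n,0,…,p-1
  outKey : ℕ → ℕ
  outKey o = if q <ᵇ o then o ∸ suc q else o + (n ∸ q)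

  bothIn neitherIn oneIn : Arc → Bool
  bothIn    e = inside (proj₁ e) ∧ inside (proj₂ e)
  neitherIn e = not (inside (proj₁ e)) ∧ not (inside (proj₂ e))
  oneIn     e = not (bothIn e) ∧ not (neitherIn e)

  innerEnd outerEnd : Arc → ℕ
  innerEnd e = if inside (proj₁ e) then proj₁ e else proj₂ e
  outerEnd e = if inside (proj₁ e) then proj₂ e else proj₁ e

  -- action of s_{p,q}: reflect the part of the diagram inside the chord
  -- separating positions p..q, and rejoin the arcs crossing the chord.
  -- Crossing arcs, listed along the chord from the p-end, have inner
  -- endpoints ascending and outer endpoints in decreasing clockwise order;
  -- after reflection the j-th outer piece meets the j-th smallest
  -- reflected inner endpoint.
  actGen : Diagram → Diagram
  actGen x = diagram (λ i → lab x (refl-pos i))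
    (map (λ e → refl-pos (proj₁ e) , refl-pos (proj₂ e)) (filterᵇ bothIn (arcs x))
     ++ filterᵇ neitherIn (arcs x)
     ++ zip (reverse (sortBy outKey (map outerEnd (filterᵇ oneIn (arcs x)))))
            (sortBy (λ i → i) (map (λ e → refl-pos (innerEnd e)) (filterᵇ oneIn (arcs x)))))

-- action of a word (products act right to left)
act : (n : ℕ) → Word n → Diagram → Diagram
act n []            x = x
act n ((p , q , _) ∷ w) x = actGen n p q (act n w x)

-- For d ∈ ℕ, d divides G(x) exactly when d divides the number of arcs of x satisfying P, for
-- every predicate P on unordered pairs of positions, and each generator s_{p,q} preserves this
-- property. Arcs with both ends on the same side of the chord are merely reflected or kept. The
-- arcs crossing the chord do not cross each other, so listed by inner endpoint their outer
-- endpoints decrease in clockwise order; for such a monotone family every initial segment is cut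
-- out by a condition on one endpoint alone, so d divides all its multiplicities as soon as d
-- divides all counts of outer endpoints and all counts of inner endpoints. The action replaces
-- the crossing arcs by another monotone family with the same outer endpoints and reflected inner
-- endpoints, so these marginal counts, and with them the property, are preserved.

module Submission where

open import Defs
open import Data.Bool using (Bool; true; false; not; _∧_; _∨_)
open import Data.Bool.Properties using (∧-identityʳ; ∧-zeroʳ; ∧-inverseˡ; ∧-comm; ∨-comm; T-≡)
open import Data.Empty using (⊥)
open import Data.Fin using (Fin)
open import Data.List using (List; []; _∷_; _++_; map; filterᵇ; foldr; reverse; zip; length; upTo; concatMap)
open import Data.List.Membership.Propositional using (_∈_; find; lose)
open import Data.List.Membership.Propositional.Properties
  using (∈-map⁺; ∈-map⁻; ∈-++⁻; ∈-concat⁺′; ∈-concat⁻′; ∈-filter⁺; ∈-filter⁻; ∈-upTo⁺; ∈-upTo⁻)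
open import Data.List.Properties using (map-++; map-∘; length-filter; length-map; unfold-reverse)
open import Data.List.Relation.Unary.All as All using (All; []; _∷_)
open import Data.List.Relation.Unary.AllPairs using (AllPairs; []; _∷_)
import Data.List.Relation.Unary.AllPairs.Properties as AllPairsₚ
open import Data.List.Relation.Unary.Any using (here; there; any?)
open import Data.List.Relation.Binary.Permutation.Propositional using (_↭_; ↭-refl; ↭-sym; ↭-trans; ↭-prep; ↭-swap)
import Data.List.Relation.Binary.Permutation.Propositional.Properties as ↭
open import Data.Nat
open import Data.Nat.Divisibility
open import Data.Nat.GCD using (gcd; gcd[m,n]∣m; gcd[m,n]∣n; gcd-greatest)
open import Data.Nat.ListAction using (sum)
open import Data.Nat.ListAction.Properties using (sum-++; sum-↭)
open import Data.Nat.Properties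
open import Data.Product using (_×_; _,_; proj₁; proj₂; ∃; <_,_>)
open import Data.Product.Properties using (≡-dec; ,-injective)
open import Data.Sum using (_⊎_; inj₁; inj₂)
open import Function using (_∘_; id; flip; _on_; _⇔_; mk⇔; Equivalence)
import Function.Properties.Equivalence as ⇔
open import Relation.Binary.Definitions using (DecidableEquality; tri<; tri≈; tri>)
open import Relation.Binary.PropositionalEquality
open import Relation.Nullary using (Dec; does; yes; no; ¬_; _×-dec_; _⊎-dec_; ¬?; contradiction)
open import Relation.Nullary.Decidable using (T?; dec-true; dec-false; does-⇔)

private variable
  A B : Set

count : (A → Bool) → List A → ℕ
count P xs = sum (map (λ x → ind (P x)) xs)

module _ (P : A → Bool) where

  count-++ : ∀ xs ys → count P (xs ++ ys) ≡ count P xs + count P ys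
  count-++ xs ys = trans (cong sum (map-++ _ xs ys)) (sum-++ (map (λ x → ind (P x)) xs) _)

  count-↭ : ∀ {xs ys} → xs ↭ ys → count P xs ≡ count P ys
  count-↭ p = sum-↭ (↭.map⁺ _ p)

  count-map : (f : B → A) (xs : List B) → count P (map f xs) ≡ count (P ∘ f) xs
  count-map f xs = cong sum (sym (map-∘ xs))

  count-filterᵇ : (Q : A → Bool) (xs : List A) → count P (filterᵇ Q xs) ≡ count (λ x → Q x ∧ P x) xs
  count-filterᵇ Q [] = refl
  count-filterᵇ Q (x ∷ xs) with Q x
  ... | true  = cong (ind (P x) +_) (count-filterᵇ Q xs)
  ... | false = count-filterᵇ Q xs

count-cong : {P Q : A → Bool} (xs : List A) → (∀ x → x ∈ xs → P x ≡ Q x) → count P xs ≡ count Q xs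
count-cong [] _ = refl
count-cong (x ∷ xs) P≡Q = cong₂ _+_ (cong ind (P≡Q x (here refl))) (count-cong xs (λ y y∈ → P≡Q y (there y∈)))

count-false : (xs : List A) → count (λ _ → false) xs ≡ 0
count-false [] = refl
count-false (x ∷ xs) = count-false xs

count-split : (P Q : A → Bool) (xs : List A) →
              count Q xs ≡ count (λ x → P x ∧ Q x) xs + count (λ x → not (P x) ∧ Q x) xs
count-split P Q [] = refl
count-split P Q (x ∷ xs) with P x | Q x
... | true  | true  = cong suc (count-split P Q xs)
... | true  | false = count-split P Q xs
... | false | true  = trans (cong suc (count-split P Q xs)) (sym (+-suc _ _))
... | false | false = count-split P Q xs

count-none : {P : A → Set} (P? : ∀ x → Dec (P x)) (xs : List A) → (∀ {x} → x ∈ xs → ¬ P x) →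
             count (does ∘ P?) xs ≡ 0
count-none P? xs none = trans (count-cong xs (λ x x∈ → dec-false (P? x) (none x∈))) (count-false xs)

∈-filterᵇ⁻ : (P : A → Bool) {xs : List A} {x : A} → x ∈ filterᵇ P xs → x ∈ xs × P x ≡ true
∈-filterᵇ⁻ P x∈ = let x∈xs , Px = ∈-filter⁻ (T? ∘ P) x∈ in x∈xs , Equivalence.to T-≡ Px

does≡true⇒ : {P : Set} (P? : Dec P) → does P? ≡ true → P
does≡true⇒ (yes p) _ = p

does≡false⇒ : {P : Set} (P? : Dec P) → does P? ≡ false → ¬ P
does≡false⇒ (no ¬p) _ = ¬p

module _ {A B : Set} (_≟_ : DecidableEquality B) (K : A → B) where

  fibre : B → A → Bool
  fibre b x = does (K x ≟ b)

  ConstantOnFibres : (A → Bool) → List A → Set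
  ConstantOnFibres Q xs = ∀ {x y} → x ∈ xs → y ∈ xs → K x ≡ K y → Q x ≡ Q y

  fibre-∧-∣ : ∀ {d b xs t} (Q : A → Bool) → d ∣ count (fibre b) xs → (∀ {y} → y ∈ xs → K y ≡ b → Q y ≡ t) →
              d ∣ count (λ y → fibre b y ∧ Q y) xs
  fibre-∧-∣ {d} {b} {xs} {t} Q ∣fibre Q≡t = subst (d ∣_) (sym (count-cong xs Q≡t′)) (∣∧ t)
    where
    Q≡t′ : ∀ y → y ∈ xs → fibre b y ∧ Q y ≡ fibre b y ∧ t
    Q≡t′ y y∈ with K y ≟ b
    ... | yes Ky≡b = Q≡t y∈ Ky≡b
    ... | no  _    = refl
    ∣∧ : ∀ t → d ∣ count (λ y → fibre b y ∧ t) xs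
    ∣∧ true  = subst (d ∣_) (sym (count-cong xs (λ y _ → ∧-identityʳ (fibre b y)))) ∣fibre
    ∣∧ false = subst (d ∣_) (sym (trans (count-cong xs (λ y _ → ∧-zeroʳ (fibre b y))) (count-false xs))) (d ∣0)

  count-fibre-removed : ∀ b xs → count (fibre b) (filterᵇ (not ∘ fibre b) xs) ≡ 0
  count-fibre-removed b xs =
    trans (count-filterᵇ (fibre b) _ xs) (trans (count-cong xs (λ y _ → ∧-inverseˡ (fibre b y))) (count-false xs))

  count-other-fibre : ∀ {b c} → b ≢ c → ∀ xs → count (fibre c) (filterᵇ (not ∘ fibre b) xs) ≡ count (fibre c) xs
  count-other-fibre {b} {c} b≢c xs = trans (count-filterᵇ (fibre c) _ xs) (count-cong xs outside-b)
    where
    outside-b : ∀ y → y ∈ xs → not (fibre b y) ∧ fibre c y ≡ fibre c y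
    outside-b y _ with K y ≟ c
    ... | yes refl rewrite dec-false (K y ≟ b) (b≢c ∘ sym) = refl
    ... | no _     = ∧-zeroʳ _

  fibres-∣⇒count-∣ : ∀ {d} xs → (∀ b → d ∣ count (fibre b) xs) →
                     ∀ Q → ConstantOnFibres Q xs → d ∣ count Q xs
  fibres-∣⇒count-∣ {d} xs = go (length xs) xs ≤-refl
    where
    go : ∀ k xs → length xs ≤ k → (∀ b → d ∣ count (fibre b) xs) →
         ∀ Q → ConstantOnFibres Q xs → d ∣ count Q xs
    go _       []       _         _   _ _   = d ∣0
    go (suc k) (x ∷ xs) (s≤s len) fib Q cst =
      subst (d ∣_) (sym (count-split (fibre b) Q (x ∷ xs)))
        (∣m∣n⇒∣m+n (fibre-∧-∣ Q (fib b) (λ y∈ Ky≡b → cst y∈ (here refl) Ky≡b))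
                   (subst (d ∣_) rest≡ (go k rest (≤-trans (length-filter _ xs) len) fibres-rest Q cst-rest)))
      where
      b = K x
      rest = filterᵇ (not ∘ fibre b) xs

      rest≡ : count Q rest ≡ count (λ y → not (fibre b y) ∧ Q y) (x ∷ xs)
      rest≡ = trans (count-filterᵇ Q _ xs)
                (cong (λ t → ind (not t ∧ Q x) + count (λ y → not (fibre b y) ∧ Q y) xs) (sym (dec-true (b ≟ b) refl)))

      fibres-rest : ∀ c → d ∣ count (fibre c) rest
      fibres-rest c with b ≟ c
      ... | yes refl = subst (d ∣_) (sym (count-fibre-removed b xs)) (d ∣0)
      ... | no b≢c   = subst (d ∣_) (sym (count-other-fibre b≢c xs))
                         (subst (λ t → d ∣ ind t + count (fibre c) xs) (dec-false (b ≟ c) b≢c) (fib c))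

      cst-rest : ConstantOnFibres Q rest
      cst-rest y∈ z∈ = cst (there (proj₁ (∈-filterᵇ⁻ _ y∈))) (there (proj₁ (∈-filterᵇ⁻ _ z∈)))

-- Lists with two antitone keys

_≟²_ : (a b : ℕ × ℕ) → Dec (a ≡ b)
_≟²_ = ≡-dec _≟_ _≟_

module _ {A : Set} (k₁ k₂ : A → ℕ) where

  Antitone : List A → Set
  Antitone xs = ∀ {x y} → x ∈ xs → y ∈ xs → k₂ x < k₂ y → k₁ y ≤ k₁ x

  Below : ℕ → ℕ → A → Set
  Below i k x = k₂ x < i ⊎ (k₂ x ≡ i × k ≤ k₁ x)

  below? : ∀ i k x → Dec (Below i k x)
  below? i k x = k₂ x <? i ⊎-dec (k₂ x ≟ i ×-dec k ≤? k₁ x)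

  module _ {d : ℕ} {xs : List A} (anti : Antitone xs)
           (∣k₁ : ∀ R → d ∣ count (R ∘ k₁) xs) (∣k₂ : ∀ R → d ∣ count (R ∘ k₂) xs) where

    private
      below-∣-via : ∀ {i k} {P : ℕ → Set} (P? : ∀ j → Dec (P j)) (f : A → ℕ) →
                    (∀ {x} → x ∈ xs → P (f x) → Below i k x) → (∀ {x} → x ∈ xs → Below i k x → P (f x)) →
                    d ∣ count (λ x → does (P? (f x))) xs → d ∣ count (does ∘ below? i k) xs
      below-∣-via {i} {k} P? f to from ∣P =
        subst (d ∣_) (count-cong xs (λ x x∈ → does-⇔ (mk⇔ (to x∈) (from x∈)) (P? (f x)) (below? i k x))) ∣P

      below-∣-no-lower : ∀ {i k} → (∀ {x} → x ∈ xs → ¬ (k₂ x ≡ i × k₁ x < k)) → d ∣ count (does ∘ below? i k) xs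
      below-∣-no-lower {i} {k} noLower = below-∣-via (_≤? i) k₂ to from (∣k₂ (λ j → does (j ≤? i)))
        where
        to : ∀ {x} → x ∈ xs → k₂ x ≤ i → Below i k x
        to x∈ x≤i with m≤n⇒m<n∨m≡n x≤i
        ... | inj₁ x<i = inj₁ x<i
        ... | inj₂ x≡i = inj₂ (x≡i , ≮⇒≥ (λ x<k → noLower x∈ (x≡i , x<k)))
        from : ∀ {x} → x ∈ xs → Below i k x → k₂ x ≤ i
        from _ (inj₁ x<i)       = <⇒≤ x<i
        from _ (inj₂ (x≡i , _)) = ≤-reflexive x≡i

      below-∣-no-upper : ∀ {i k} → (∀ {x} → x ∈ xs → ¬ (k₂ x ≡ i × k ≤ k₁ x)) → d ∣ count (does ∘ below? i k) xs
      below-∣-no-upper {i} {k} noUpper = below-∣-via (_<? i) k₂ (λ _ → inj₁) from (∣k₂ (λ j → does (j <? i)))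
        where
        from : ∀ {x} → x ∈ xs → Below i k x → k₂ x < i
        from _  (inj₁ x<i)   = x<i
        from x∈ (inj₂ upper) = contradiction upper (noUpper x∈)

      below-∣-straddled : ∀ {i k g h} → g ∈ xs → k₂ g ≡ i × k ≤ k₁ g → h ∈ xs → k₂ h ≡ i × k₁ h < k →
                          d ∣ count (does ∘ below? i k) xs
      below-∣-straddled {i} {k} {g} {h} g∈ (g₂≡i , k≤g₁) h∈ (h₂≡i , h₁<k) =
        below-∣-via (k ≤?_) k₁ to from (∣k₁ (λ j → does (k ≤? j)))
        where
        to : ∀ {x} → x ∈ xs → k ≤ k₁ x → Below i k x
        to {x} x∈ k≤x with <-cmp (k₂ x) i
        ... | tri< x<i _ _ = inj₁ x<i
        ... | tri≈ _ x≡i _ = inj₂ (x≡i , k≤x)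
        ... | tri> _ _ i<x = contradiction (≤-<-trans (anti h∈ x∈ (subst (_< k₂ x) (sym h₂≡i) i<x)) h₁<k) (≤⇒≯ k≤x)
        from : ∀ {x} → x ∈ xs → Below i k x → k ≤ k₁ x
        from x∈ (inj₁ x<i)       = ≤-trans k≤g₁ (anti x∈ g∈ (subst (_ <_) (sym g₂≡i) x<i))
        from _  (inj₂ (_ , k≤x)) = k≤x

    -- Below i k is an initial segment of the order "k₂ ascending, then k₁ descending". On an
    -- antitone list it agrees with {k₂ < i}, {k₂ ≤ i} or {k ≤ k₁}, depending on which elements
    -- with k₂ = i exist, so its count is a count of one of the two marginals.
    below-∣ : ∀ i k → d ∣ count (does ∘ below? i k) xs
    below-∣ i k with any? (λ x → k₂ x ≟ i ×-dec k₁ x <? k) xs | any? (λ x → k₂ x ≟ i ×-dec k ≤? k₁ x) xs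
    ... | no noLower | _          = below-∣-no-lower (λ x∈ lower → noLower (lose x∈ lower))
    ... | yes _      | no noUpper = below-∣-no-upper (λ x∈ upper → noUpper (lose x∈ upper))
    ... | yes lower  | yes upper  =
      let _ , h∈ , h-lower = find lower ; _ , g∈ , g-upper = find upper in below-∣-straddled g∈ g-upper h∈ h-lower

    private
      below-suc⇒below : ∀ {i k x} → Below i (suc k) x → Below i k x
      below-suc⇒below (inj₁ x<i)          = inj₁ x<i
      below-suc⇒below (inj₂ (x≡i , k<x)) = inj₂ (x≡i , <⇒≤ k<x)

      boundary⇔fibre : ∀ {i k x} → (¬ Below i (suc k) x × Below i k x) ⇔ ((k₁ x , k₂ x) ≡ (k , i))
      boundary⇔fibre {i} {k} {x} = mk⇔ to from
        where
        to : ¬ Below i (suc k) x × Below i k x → (k₁ x , k₂ x) ≡ (k , i)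
        to (¬below , inj₁ x<i)          = contradiction (inj₁ x<i) ¬below
        to (¬below , inj₂ (x≡i , k≤x)) =
          cong₂ _,_ (≤-antisym (≮⇒≥ (λ k<x → ¬below (inj₂ (x≡i , k<x)))) k≤x) x≡i
        from : (k₁ x , k₂ x) ≡ (k , i) → ¬ Below i (suc k) x × Below i k x
        from eq with ,-injective eq
        ... | refl , refl = (λ { (inj₁ x<x) → <-irrefl refl x<x ; (inj₂ (_ , k<k)) → n≮n _ k<k }) , inj₂ (refl , ≤-refl)

    fibre-∣ : ∀ c → d ∣ count (fibre _≟²_ < k₁ , k₂ > c) xs
    fibre-∣ (k , i) = ∣m+n∣m⇒∣n (subst (d ∣_) split (below-∣ i k)) (below-∣ i (suc k))
      where
      split : count (does ∘ below? i k) xs ≡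
              count (does ∘ below? i (suc k)) xs + count (fibre _≟²_ < k₁ , k₂ > (k , i)) xs
      split = trans (count-split (does ∘ below? i (suc k)) (does ∘ below? i k) xs) (cong₂ _+_
        (count-cong xs (λ x _ → does-⇔ (mk⇔ proj₁ (λ b → b , below-suc⇒below b))
                                       (below? i (suc k) x ×-dec below? i k x) (below? i (suc k) x)))
        (count-cong xs (λ x _ → does-⇔ boundary⇔fibre
                                       (¬? (below? i (suc k) x) ×-dec below? i k x) ((k₁ x , k₂ x) ≟² (k , i)))))

    antitone-marginals⇒count-∣ : ∀ Q → ConstantOnFibres _≟²_ < k₁ , k₂ > Q xs → d ∣ count Q xs
    antitone-marginals⇒count-∣ = fibres-∣⇒count-∣ _≟²_ < k₁ , k₂ > xs fibre-∣

module _ (k : ℕ → ℕ) where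

  insertBy-↭ : ∀ v xs → insertBy k v xs ↭ v ∷ xs
  insertBy-↭ v [] = ↭-refl
  insertBy-↭ v (w ∷ ws) with k v ≤ᵇ k w
  ... | true  = ↭-refl
  ... | false = ↭-trans (↭-prep w (insertBy-↭ v ws)) (↭-swap w v ↭-refl)

  sortBy-↭ : ∀ xs → sortBy k xs ↭ xs
  sortBy-↭ []       = ↭-refl
  sortBy-↭ (v ∷ vs) = ↭-trans (insertBy-↭ v (sortBy k vs)) (↭-prep v (sortBy-↭ vs))

  insertBy-ascending : ∀ v {xs} → AllPairs (_≤_ on k) xs → AllPairs (_≤_ on k) (insertBy k v xs)
  insertBy-ascending v {[]}     []       = [] ∷ []
  insertBy-ascending v {w ∷ ws} (w≤ws ∷ ws↑) with k v ≤ᵇ k w in eq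
  ... | true  = (v≤w ∷ All.map (≤-trans v≤w) w≤ws) ∷ w≤ws ∷ ws↑
    where v≤w = does≡true⇒ (k v ≤? k w) eq
  ... | false = ↭.All-resp-↭ (↭-sym (insertBy-↭ v ws)) (w≤v ∷ w≤ws) ∷ insertBy-ascending v ws↑
    where w≤v = ≰⇒≥ (does≡false⇒ (k v ≤? k w) eq)

  sortBy-ascending : ∀ xs → AllPairs (_≤_ on k) (sortBy k xs)
  sortBy-ascending []       = []
  sortBy-ascending (v ∷ vs) = insertBy-ascending v (sortBy-ascending vs)

module _ {R : A → A → Set} where

  AllPairs-reverse : ∀ {xs} → AllPairs R xs → AllPairs (flip R) (reverse xs)
  AllPairs-reverse {[]}     []           = []
  AllPairs-reverse {x ∷ xs} (x≤xs ∷ xs↑) rewrite unfold-reverse x xs =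
    AllPairsₚ.++⁺ (AllPairs-reverse xs↑) ([] ∷ []) (All.map (_∷ []) (↭.All-resp-↭ (↭-sym (↭.↭-reverse xs)) x≤xs))

  AllPairs-∈ : ∀ {xs x y} → AllPairs R xs → x ∈ xs → y ∈ xs → x ≡ y ⊎ R x y ⊎ R y x
  AllPairs-∈ (_ ∷ _)   (here refl) (here refl) = inj₁ refl
  AllPairs-∈ (x≤ ∷ _)  (here refl) (there y∈) = inj₂ (inj₁ (All.lookup x≤ y∈))
  AllPairs-∈ (x≤ ∷ _)  (there x∈) (here refl) = inj₂ (inj₂ (All.lookup x≤ x∈))
  AllPairs-∈ (_ ∷ xs↑) (there x∈) (there y∈) = AllPairs-∈ xs↑ x∈ y∈

∈-zip⁻ : ∀ {xs : List A} {ys : List B} {g} → g ∈ zip xs ys → proj₁ g ∈ xs × proj₂ g ∈ ys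
∈-zip⁻ {xs = _ ∷ _} {_ ∷ _} (here refl) = here refl , here refl
∈-zip⁻ {xs = _ ∷ _} {_ ∷ _} (there g∈) = let x∈ , y∈ = ∈-zip⁻ g∈ in there x∈ , there y∈

AllPairs-zip : ∀ {R : A → A → Set} {S : B → B → Set} {xs ys} → AllPairs R xs → AllPairs S ys →
               AllPairs (λ g h → R (proj₁ g) (proj₁ h) × S (proj₂ g) (proj₂ h)) (zip xs ys)
AllPairs-zip []          _           = []
AllPairs-zip (_ ∷ _)     []          = []
AllPairs-zip (x≤ ∷ xs↑) (y≤ ∷ ys↑) =
  All.tabulate (λ g∈ → let x∈ , y∈ = ∈-zip⁻ g∈ in All.lookup x≤ x∈ , All.lookup y≤ y∈) ∷ AllPairs-zip xs↑ ys↑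

count-zip₁ : ∀ (P : A → Bool) (xs : List A) (ys : List B) → length xs ≡ length ys →
             count (P ∘ proj₁) (zip xs ys) ≡ count P xs
count-zip₁ P []       []       _  = refl
count-zip₁ P (x ∷ xs) (_ ∷ ys) eq = cong (ind (P x) +_) (count-zip₁ P xs ys (suc-injective eq))

count-zip₂ : ∀ (P : B → Bool) (xs : List A) (ys : List B) → length xs ≡ length ys →
             count (P ∘ proj₂) (zip xs ys) ≡ count P ys
count-zip₂ P []       []       _  = refl
count-zip₂ P (_ ∷ xs) (y ∷ ys) eq = cong (ind (P y) +_) (count-zip₂ P xs ys (suc-injective eq))

-- Unordered pairs and crossing chords

swap : Arc → Arc
swap (a , b) = b , a

sort : Arc → Arc
sort (a , b) = a ⊓ b , a ⊔ b

sort≡id⊎swap : ∀ e → sort e ≡ e ⊎ sort e ≡ swap e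
sort≡id⊎swap (a , b) with ≤-total a b
... | inj₁ a≤b = inj₁ (cong₂ _,_ (m≤n⇒m⊓n≡m a≤b) (m≤n⇒m⊔n≡n a≤b))
... | inj₂ b≤a = inj₂ (cong₂ _,_ (m≥n⇒m⊓n≡n b≤a) (m≥n⇒m⊔n≡m b≤a))

sort-swap : ∀ e → sort (swap e) ≡ sort e
sort-swap (a , b) = cong₂ _,_ (⊓-comm b a) (⊔-comm b a)

sort-injective : ∀ {e f} → sort e ≡ sort f → e ≡ f ⊎ e ≡ swap f
sort-injective {e@(_ , _)} {f@(_ , _)} eq with sort≡id⊎swap e | sort≡id⊎swap f
... | inj₁ e≡ | inj₁ f≡ = inj₁ (trans (sym e≡) (trans eq f≡))
... | inj₁ e≡ | inj₂ f≡ = inj₂ (trans (sym e≡) (trans eq f≡))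
... | inj₂ e≡ | inj₁ f≡ = inj₂ (cong swap (trans (sym e≡) (trans eq f≡)))
... | inj₂ e≡ | inj₂ f≡ = inj₁ (cong swap (trans (sym e≡) (trans eq f≡)))

⊓<⊔ : ∀ {c d} → c ≢ d → c ⊓ d < c ⊔ d
⊓<⊔ {c} {d} c≢d with ≤-total c d
... | inj₁ c≤d rewrite m≤n⇒m⊓n≡m c≤d | m≤n⇒m⊔n≡n c≤d = ≤∧≢⇒< c≤d c≢d
... | inj₂ d≤c rewrite m≥n⇒m⊓n≡n d≤c | m≥n⇒m⊔n≡m d≤c = ≤∧≢⇒< d≤c (c≢d ∘ sym)

sort≡⇔ : ∀ {a b c d} → a ≤ b → sort (c , d) ≡ (a , b) ⇔ (c ≡ a × d ≡ b ⊎ c ≡ b × d ≡ a)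
sort≡⇔ {a} {b} a≤b = mk⇔ to from
  where
  sorted : sort (a , b) ≡ (a , b)
  sorted = cong₂ _,_ (m≤n⇒m⊓n≡m a≤b) (m≤n⇒m⊔n≡n a≤b)
  to : ∀ {c d} → sort (c , d) ≡ (a , b) → c ≡ a × d ≡ b ⊎ c ≡ b × d ≡ a
  to eq with sort-injective (trans eq (sym sorted))
  ... | inj₁ eq′ = inj₁ (,-injective eq′)
  ... | inj₂ eq′ = inj₂ (,-injective eq′)
  from : ∀ {c d} → c ≡ a × d ≡ b ⊎ c ≡ b × d ≡ a → sort (c , d) ≡ (a , b)
  from (inj₁ (refl , refl)) = sorted
  from (inj₂ (refl , refl)) = trans (sort-swap (a , b)) sorted

Between : ℕ → ℕ → ℕ → Set
Between a b x = (a < x × x < b) ⊎ (b < x × x < a)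

Beyond : ℕ → ℕ → ℕ → Set
Beyond a b x = (x < a × x < b) ⊎ (a < x × b < x)

Separates : Arc → Arc → Set
Separates (a , b) (c , d) = (Between a b c × Beyond a b d) ⊎ (Beyond a b c × Between a b d)

Between-swap : ∀ {a b x} → Between a b x → Between b a x
Between-swap (inj₁ a<x<b) = inj₂ a<x<b
Between-swap (inj₂ b<x<a) = inj₁ b<x<a

Beyond-swap : ∀ {a b x} → Beyond a b x → Beyond b a x
Beyond-swap (inj₁ (x<a , x<b)) = inj₁ (x<b , x<a)
Beyond-swap (inj₂ (a<x , b<x)) = inj₂ (b<x , a<x)

Separates-swapˡ : ∀ {e f} → Separates e f → Separates (swap e) f
Separates-swapˡ (inj₁ (c , d)) = inj₁ (Between-swap c , Beyond-swap d)
Separates-swapˡ (inj₂ (c , d)) = inj₂ (Beyond-swap c , Between-swap d)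

Separates-swapʳ : ∀ {e f} → Separates e f → Separates e (swap f)
Separates-swapʳ (inj₁ (c , d)) = inj₂ (d , c)
Separates-swapʳ (inj₂ (c , d)) = inj₁ (d , c)

Separates-sort⁺ : ∀ e f → Separates e f → Separates (sort e) (sort f)
Separates-sort⁺ e f s with sort≡id⊎swap e | sort≡id⊎swap f
... | inj₁ e≡ | inj₁ f≡ = subst₂ Separates (sym e≡) (sym f≡) s
... | inj₁ e≡ | inj₂ f≡ = subst₂ Separates (sym e≡) (sym f≡) (Separates-swapʳ s)
... | inj₂ e≡ | inj₁ f≡ = subst₂ Separates (sym e≡) (sym f≡) (Separates-swapˡ s)
... | inj₂ e≡ | inj₂ f≡ = subst₂ Separates (sym e≡) (sym f≡) (Separates-swapˡ (Separates-swapʳ s))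

Separates-sort⁻ : ∀ e f → Separates (sort e) (sort f) → Separates e f
Separates-sort⁻ (a , b) (c , d) s with sort≡id⊎swap (a , b) | sort≡id⊎swap (c , d)
... | inj₁ e≡ | inj₁ f≡ = subst₂ Separates e≡ f≡ s
... | inj₁ e≡ | inj₂ f≡ = Separates-swapʳ (subst₂ Separates e≡ f≡ s)
... | inj₂ e≡ | inj₁ f≡ = Separates-swapˡ (subst₂ Separates e≡ f≡ s)
... | inj₂ e≡ | inj₂ f≡ = Separates-swapˡ (Separates-swapʳ (subst₂ Separates e≡ f≡ s))

private
  CrossSorted : ℕ → ℕ → ℕ → ℕ → Set
  CrossSorted a b c d = (a < c × c < b × b < d) ⊎ (c < a × a < d × d < b)

  crossSorted⇒separates : ∀ {a b c d} → a ≤ b → c ≤ d → CrossSorted a b c d → Separates (a , b) (c , d)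
  crossSorted⇒separates _   c≤d (inj₁ (a<c , c<b , b<d)) = inj₁ (inj₁ (a<c , c<b) , inj₂ (<-≤-trans a<c c≤d , b<d))
  crossSorted⇒separates a≤b _   (inj₂ (c<a , a<d , d<b)) = inj₂ (inj₁ (c<a , <-≤-trans c<a a≤b) , inj₁ (a<d , d<b))

  separates⇒crossSorted : ∀ {a b c d} → a ≤ b → c ≤ d → Separates (a , b) (c , d) → CrossSorted a b c d
  separates⇒crossSorted a≤b _   (inj₁ (inj₂ (b<c , c<a) , _))              = contradiction (<-trans b<c c<a) (≤⇒≯ a≤b)
  separates⇒crossSorted _   c≤d (inj₁ (inj₁ (a<c , _) , inj₁ (d<a , _)))   = contradiction (<-trans d<a a<c) (≤⇒≯ c≤d)
  separates⇒crossSorted _   _   (inj₁ (inj₁ (a<c , c<b) , inj₂ (_ , b<d))) = inj₁ (a<c , c<b , b<d)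
  separates⇒crossSorted a≤b _   (inj₂ (_ , inj₂ (b<d , d<a)))              = contradiction (<-trans b<d d<a) (≤⇒≯ a≤b)
  separates⇒crossSorted _   _   (inj₂ (inj₁ (c<a , _) , inj₁ (a<d , d<b))) = inj₂ (c<a , a<d , d<b)
  separates⇒crossSorted _   c≤d (inj₂ (inj₂ (_ , b<c) , inj₁ (_ , d<b)))   = contradiction (<-trans d<b b<c) (≤⇒≯ c≤d)

Cross⇒Separates : ∀ e f → Cross e f → Separates e f
Cross⇒Separates (a , b) (c , d) x =
  Separates-sort⁻ (a , b) (c , d) (crossSorted⇒separates (m⊓n≤m⊔n a b) (m⊓n≤m⊔n c d) x)

Separates⇒Cross : ∀ e f → Separates e f → Cross e f
Separates⇒Cross (a , b) (c , d) s =
  separates⇒crossSorted (m⊓n≤m⊔n a b) (m⊓n≤m⊔n c d) (Separates-sort⁺ (a , b) (c , d) s)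

Cross-sym : ∀ e f → Cross e f → Cross f e
Cross-sym (a , b) (c , d) (inj₁ x) = inj₂ x
Cross-sym (a , b) (c , d) (inj₂ x) = inj₁ x

SwapInvariant : (Arc → Bool) → Set
SwapInvariant Q = ∀ a b → Q (a , b) ≡ Q (b , a)

CountsDivisible : ℕ → List Arc → Set
CountsDivisible d xs = ∀ Q → SwapInvariant Q → d ∣ count Q xs

∧-SwapInvariant : ∀ {P Q} → SwapInvariant P → SwapInvariant Q → SwapInvariant (λ e → P e ∧ Q e)
∧-SwapInvariant P-inv Q-inv a b = cong₂ _∧_ (P-inv a b) (Q-inv a b)

-- The chord of a generator s_{p,q}

module Chord (n p q : ℕ) (p≤q : p ≤ q) (q≤n : q ≤ n) where

  Inside : ℕ → Set
  Inside i = p ≤ i × i ≤ q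

  Outside : ℕ → Set
  Outside o = o < p ⊎ q < o × o ≤ n

  ρ : ℕ → ℕ
  ρ = refl-pos n p q

  κ : ℕ → ℕ
  κ = outKey n p q

  -- inside n p q i is definitionally does (p ≤? i ×-dec i ≤? q).
  inside≡true⇒ : ∀ {i} → inside n p q i ≡ true → Inside i
  inside≡true⇒ {i} = does≡true⇒ (p ≤? i ×-dec i ≤? q)

  inside≡false⇒ : ∀ {o} → o ≤ n → inside n p q o ≡ false → Outside o
  inside≡false⇒ {o} o≤n h with does≡false⇒ (p ≤? o ×-dec o ≤? q) h | p ≤? o
  ... | ¬inside | no  p≰o = inj₁ (≰⇒> p≰o)
  ... | ¬inside | yes p≤o = inj₂ (≰⇒> (λ o≤q → ¬inside (p≤o , o≤q)) , o≤n)

  Inside⇒inside≡true : ∀ {i} → Inside i → inside n p q i ≡ true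
  Inside⇒inside≡true {i} = dec-true (p ≤? i ×-dec i ≤? q)

  Outside⇒inside≡false : ∀ {o} → Outside o → inside n p q o ≡ false
  Outside⇒inside≡false {o} out = dec-false (p ≤? o ×-dec o ≤? q) (λ { (p≤o , o≤q) → ¬in out p≤o o≤q })
    where
    ¬in : Outside o → p ≤ o → o ≤ q → ⊥
    ¬in (inj₁ o<p)       p≤o _   = <⇒≱ o<p p≤o
    ¬in (inj₂ (q<o , _)) _   o≤q = <⇒≱ q<o o≤q

  Outside⇒≤ : ∀ {o} → Outside o → o ≤ n
  Outside⇒≤ (inj₁ o<p)         = ≤-trans (<⇒≤ o<p) (≤-trans p≤q q≤n)
  Outside⇒≤ (inj₂ (_ , o≤n)) = o≤n

  Inside⇒≤ : ∀ {i} → Inside i → i ≤ n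
  Inside⇒≤ (_ , i≤q) = ≤-trans i≤q q≤n

  ρ-inside : ∀ {i} → Inside i → ρ i ≡ p + q ∸ i
  ρ-inside ins rewrite Inside⇒inside≡true ins = refl

  Inside-ρ : ∀ {i} → Inside i → Inside (ρ i)
  Inside-ρ {i} ins@(p≤i , i≤q) rewrite ρ-inside ins =
    subst (_≤ p + q ∸ i) (m+n∸n≡m p q) (∸-monoʳ-≤ (p + q) i≤q) ,
    subst (p + q ∸ i ≤_) (m+n∸m≡n i q) (∸-monoˡ-≤ i (+-monoˡ-≤ q p≤i))

  ρ-involutive : ∀ i → ρ (ρ i) ≡ i
  ρ-involutive i with inside n p q i in eq
  ... | false rewrite eq = refl
  ... | true  = trans (ρ-inside (subst Inside (ρ-inside ins) (Inside-ρ ins)))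
                      (m∸[m∸n]≡n (≤-trans (proj₂ ins) (m≤n+m q p)))
    where ins = inside≡true⇒ eq

  ρ-injective : ∀ {i j} → ρ i ≡ ρ j → i ≡ j
  ρ-injective {i} {j} eq = trans (sym (ρ-involutive i)) (trans (cong ρ eq) (ρ-involutive j))

  ρ-≤ : ∀ {i} → i ≤ n → ρ i ≤ n
  ρ-≤ {i} i≤n with inside n p q i in eq
  ... | false = i≤n
  ... | true  = subst (_≤ n) (ρ-inside ins) (Inside⇒≤ (Inside-ρ ins))
    where ins = inside≡true⇒ eq

  ρ-reverses : ∀ {x y} → Inside x → Inside y → x < y → ρ y < ρ x
  ρ-reverses inx iny x<y rewrite ρ-inside inx | ρ-inside iny = ∸-monoʳ-< x<y (≤-trans (proj₂ iny) (m≤n+m q p))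

  ρ-reverses⁻ : ∀ {x y} → Inside x → Inside y → ρ y < ρ x → x < y
  ρ-reverses⁻ {x} {y} inx iny lt =
    subst₂ _<_ (ρ-involutive x) (ρ-involutive y) (ρ-reverses (Inside-ρ iny) (Inside-ρ inx) lt)

  Between-ρ⁻ : ∀ {a b x} → Inside a → Inside b → Inside x → Between (ρ a) (ρ b) (ρ x) → Between a b x
  Between-ρ⁻ ina inb inx (inj₁ (u , v)) = inj₂ (ρ-reverses⁻ inb inx v , ρ-reverses⁻ inx ina u)
  Between-ρ⁻ ina inb inx (inj₂ (u , v)) = inj₁ (ρ-reverses⁻ ina inx v , ρ-reverses⁻ inx inb u)

  Beyond-ρ⁻ : ∀ {a b x} → Inside a → Inside b → Inside x → Beyond (ρ a) (ρ b) (ρ x) → Beyond a b x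
  Beyond-ρ⁻ ina inb inx (inj₁ (u , v)) = inj₂ (ρ-reverses⁻ ina inx u , ρ-reverses⁻ inb inx v)
  Beyond-ρ⁻ ina inb inx (inj₂ (u , v)) = inj₁ (ρ-reverses⁻ inx ina u , ρ-reverses⁻ inx inb v)

  Separates-ρ⁻ : ∀ {a b c d} → Inside a → Inside b → Inside c → Inside d →
                 Separates (ρ a , ρ b) (ρ c , ρ d) → Separates (a , b) (c , d)
  Separates-ρ⁻ ina inb inc ind (inj₁ (u , v)) = inj₁ (Between-ρ⁻ ina inb inc u , Beyond-ρ⁻ ina inb ind v)
  Separates-ρ⁻ ina inb inc ind (inj₂ (u , v)) = inj₂ (Beyond-ρ⁻ ina inb inc u , Between-ρ⁻ ina inb ind v)

  Between-Inside : ∀ {a b x} → Inside a → Inside b → Between a b x → Inside x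
  Between-Inside ina inb (inj₁ (a<x , x<b)) = ≤-trans (proj₁ ina) (<⇒≤ a<x) , ≤-trans (<⇒≤ x<b) (proj₂ inb)
  Between-Inside ina inb (inj₂ (b<x , x<a)) = ≤-trans (proj₁ inb) (<⇒≤ b<x) , ≤-trans (<⇒≤ x<a) (proj₂ ina)

  private
    low<inside : ∀ {o i} → o < p → Inside i → o < i
    low<inside o<p ins = <-≤-trans o<p (proj₁ ins)

    inside<high : ∀ {o i} → q < o → Inside i → i < o
    inside<high q<o ins = ≤-<-trans (proj₂ ins) q<o

  Outside⇒Beyond : ∀ {a b o} → Inside a → Inside b → Outside o → Beyond a b o
  Outside⇒Beyond ina inb (inj₁ o<p)       = inj₁ (low<inside o<p ina , low<inside o<p inb)
  Outside⇒Beyond ina inb (inj₂ (q<o , _)) = inj₂ (inside<high q<o ina , inside<high q<o inb)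

  private
    move-< : ∀ {c x y} → Outside c → Inside x → Inside y → c < x → c < y
    move-< (inj₁ c<p)       _   iny _   = low<inside c<p iny
    move-< (inj₂ (q<c , _)) inx _   c<x = contradiction (inside<high q<c inx) (<-asym c<x)

    move-> : ∀ {c x y} → Outside c → Inside x → Inside y → x < c → y < c
    move-> (inj₁ c<p)       inx _   x<c = contradiction (low<inside c<p inx) (<-asym x<c)
    move-> (inj₂ (q<c , _)) _   iny _   = inside<high q<c iny

  Separates-move : ∀ {c d o x y} → Outside c → Outside d → Inside x → Inside y →
                   Separates (c , d) (o , x) → Separates (c , d) (o , y)
  Separates-move outc outd inx iny (inj₁ (b , inj₁ (u , v))) = inj₁ (b , inj₁ (move-> outc inx iny u , move-> outd inx iny v))
  Separates-move outc outd inx iny (inj₁ (b , inj₂ (u , v))) = inj₁ (b , inj₂ (move-< outc inx iny u , move-< outd inx iny v))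
  Separates-move outc outd inx iny (inj₂ (b , inj₁ (u , v))) = inj₂ (b , inj₁ (move-< outc inx iny u , move-> outd inx iny v))
  Separates-move outc outd inx iny (inj₂ (b , inj₂ (u , v))) = inj₂ (b , inj₂ (move-< outd inx iny u , move-> outc inx iny v))

  private
    κ-high : ∀ {o} → q < o → κ o ≡ o ∸ suc q
    κ-high {o} q<o rewrite dec-true (q <? o) q<o = refl

    κ-low : ∀ {o} → o < p → κ o ≡ o + (n ∸ q)
    κ-low {o} o<p rewrite dec-false (q <? o) (<-asym (<-≤-trans o<p p≤q)) = refl

    κ-high-< : ∀ {o₁ o₂} → q < o₁ → q < o₂ → o₁ < o₂ → κ o₁ < κ o₂
    κ-high-< q<o₁ q<o₂ o₁<o₂ rewrite κ-high q<o₁ | κ-high q<o₂ = ∸-monoˡ-< o₁<o₂ q<o₁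

    κ-low-< : ∀ {o₁ o₂} → o₁ < p → o₂ < p → o₁ < o₂ → κ o₁ < κ o₂
    κ-low-< o₁<p o₂<p o₁<o₂ rewrite κ-low o₁<p | κ-low o₂<p = +-monoˡ-< (n ∸ q) o₁<o₂

    κ-high<low : ∀ {o₁ o₂} → q < o₁ → o₁ ≤ n → o₂ < p → κ o₁ < κ o₂
    κ-high<low {o₁} {o₂} q<o₁ o₁≤n o₂<p rewrite κ-high q<o₁ | κ-low o₂<p =
      ≤-<-trans (∸-monoˡ-≤ (suc q) o₁≤n) (<-≤-trans (∸-monoʳ-< (n<1+n q) (<-≤-trans q<o₁ o₁≤n)) (m≤n+m (n ∸ q) o₂))

    κ-<⇒< : ∀ {o₁ o₂} → (q < o₁ × q < o₂) ⊎ (o₁ < p × o₂ < p) → κ o₁ < κ o₂ → o₁ < o₂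
    κ-<⇒< {o₁} {o₂} same κ₁<κ₂ with <-cmp o₁ o₂ | same
    ... | tri< o₁<o₂ _ _ | _                  = o₁<o₂
    ... | tri≈ _ refl _  | _                  = contradiction κ₁<κ₂ (<-irrefl refl)
    ... | tri> _ _ o₂<o₁ | inj₁ (q<o₁ , q<o₂) = contradiction κ₁<κ₂ (<-asym (κ-high-< q<o₂ q<o₁ o₂<o₁))
    ... | tri> _ _ o₂<o₁ | inj₂ (o₁<p , o₂<p) = contradiction κ₁<κ₂ (<-asym (κ-low-< o₂<p o₁<p o₂<o₁))

  κ-injective : ∀ {o₁ o₂} → Outside o₁ → Outside o₂ → κ o₁ ≡ κ o₂ → o₁ ≡ o₂
  κ-injective (inj₁ o₁<p) (inj₁ o₂<p) eq rewrite κ-low o₁<p | κ-low o₂<p = +-cancelʳ-≡ _ _ _ eq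
  κ-injective (inj₂ (q<o₁ , _)) (inj₂ (q<o₂ , _)) eq rewrite κ-high q<o₁ | κ-high q<o₂ = ∸-cancelʳ-≡ q<o₁ q<o₂ eq
  κ-injective (inj₁ o₁<p) (inj₂ (q<o₂ , o₂≤n)) eq = contradiction (sym eq) (<⇒≢ (κ-high<low q<o₂ o₂≤n o₁<p))
  κ-injective (inj₂ (q<o₁ , o₁≤n)) (inj₁ o₂<p) eq = contradiction eq (<⇒≢ (κ-high<low q<o₁ o₁≤n o₂<p))

  discordant⇒Separates : ∀ {o₁ i₁ o₂ i₂} → Outside o₁ → Outside o₂ → Inside i₁ → Inside i₂ →
                         i₁ < i₂ → κ o₁ < κ o₂ → Separates (o₁ , i₁) (o₂ , i₂)
  discordant⇒Separates (inj₂ (q<o₁ , _)) (inj₂ (q<o₂ , _)) in₁ in₂ i₁<i₂ κ₁<κ₂ =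
    inj₂ (inj₂ (κ-<⇒< (inj₁ (q<o₁ , q<o₂)) κ₁<κ₂ , inside<high q<o₂ in₁) , inj₂ (i₁<i₂ , inside<high q<o₁ in₂))
  discordant⇒Separates (inj₁ o₁<p) (inj₁ o₂<p) in₁ in₂ i₁<i₂ κ₁<κ₂ =
    inj₁ (inj₁ (κ-<⇒< (inj₂ (o₁<p , o₂<p)) κ₁<κ₂ , low<inside o₂<p in₁) , inj₂ (low<inside o₁<p in₂ , i₁<i₂))
  discordant⇒Separates (inj₂ (q<o₁ , _)) (inj₁ o₂<p) in₁ in₂ i₁<i₂ _ =
    inj₂ (inj₁ (<-trans (<-≤-trans o₂<p p≤q) q<o₁ , low<inside o₂<p in₁) , inj₂ (i₁<i₂ , inside<high q<o₁ in₂))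
  discordant⇒Separates (inj₁ o₁<p) (inj₂ (q<o₂ , o₂≤n)) _ _ _ κ₁<κ₂ =
    contradiction κ₁<κ₂ (<-asym (κ-high<low q<o₂ o₂≤n o₁<p))

  Separates⇒discordant : ∀ {o₁ i₁ o₂ i₂} → Outside o₁ → Outside o₂ → Inside i₁ → Inside i₂ →
                         Separates (o₁ , i₁) (o₂ , i₂) → (i₁ < i₂ × κ o₁ < κ o₂) ⊎ (i₂ < i₁ × κ o₂ < κ o₁)
  Separates⇒discordant (inj₂ (a , _)) (inj₂ (b , _)) in₁ in₂ s with s
  ... | inj₁ (inj₁ (_ , y) , _)            = contradiction y (<-asym (inside<high b in₁))
  ... | inj₁ (inj₂ (_ , y) , inj₁ (_ , w)) = inj₂ (w , κ-high-< b a y)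
  ... | inj₁ (inj₂ _ , inj₂ (z , _))       = contradiction z (<-asym (inside<high a in₂))
  ... | inj₂ (inj₁ (_ , y) , _)            = contradiction y (<-asym (inside<high b in₁))
  ... | inj₂ (inj₂ _ , inj₁ (z , _))       = contradiction z (<-asym (inside<high a in₂))
  ... | inj₂ (inj₂ (x , _) , inj₂ (z , _)) = inj₁ (z , κ-high-< a b x)
  Separates⇒discordant (inj₁ a) (inj₁ b) in₁ in₂ s with s
  ... | inj₁ (inj₁ _ , inj₁ (z , _))       = contradiction z (<-asym (low<inside a in₂))
  ... | inj₁ (inj₁ (x , _) , inj₂ (_ , w)) = inj₁ (w , κ-low-< a b x)
  ... | inj₁ (inj₂ (x , _) , _)            = contradiction x (<-asym (low<inside b in₁))
  ... | inj₂ (inj₁ (z , _) , inj₁ (_ , y)) = inj₂ (y , κ-low-< b a z)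
  ... | inj₂ (inj₂ (_ , w) , _)            = contradiction w (<-asym (low<inside b in₁))
  ... | inj₂ (inj₁ _ , inj₂ (_ , y))       = contradiction y (<-asym (low<inside a in₂))
  Separates⇒discordant (inj₂ (a , o₁≤n)) (inj₁ b) in₁ in₂ s with s
  ... | inj₁ (inj₁ (x , _) , _) = contradiction x (<-asym (<-trans (<-≤-trans b p≤q) a))
  ... | inj₁ (inj₂ (x , _) , _) = contradiction x (<-asym (low<inside b in₁))
  ... | inj₂ (_ , inj₁ (x , _)) = contradiction x (<-asym (inside<high a in₂))
  ... | inj₂ (_ , inj₂ (x , _)) = inj₁ (x , κ-high<low a o₁≤n b)
  Separates⇒discordant (inj₁ a) (inj₂ (b , o₂≤n)) in₁ in₂ s with s
  ... | inj₁ (inj₁ (_ , y) , _) = contradiction y (<-asym (inside<high b in₁))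
  ... | inj₁ (inj₂ (_ , y) , _) = contradiction y (<-asym (<-trans a (≤-<-trans p≤q b)))
  ... | inj₂ (_ , inj₁ (_ , y)) = inj₂ (y , κ-high<low b o₂≤n a)
  ... | inj₂ (_ , inj₂ (_ , y)) = contradiction y (<-asym (low<inside a in₂))


  both neither one : Arc → Bool
  both    = bothIn n p q
  neither = neitherIn n p q
  one     = oneIn n p q

  outer inner : Arc → ℕ
  outer = outerEnd n p q
  inner = innerEnd n p q

  orient : Arc → Arc
  orient e = outer e , inner e

  reflect : Arc → Arc
  reflect e = ρ (proj₁ e) , ρ (proj₂ e)

  reflect-involutive : ∀ e → reflect (reflect e) ≡ e
  reflect-involutive (a , b) = cong₂ _,_ (ρ-involutive a) (ρ-involutive b)

  both-swap : SwapInvariant both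
  both-swap a b = ∧-comm (inside n p q a) (inside n p q b)

  neither-swap : SwapInvariant neither
  neither-swap a b = ∧-comm (not (inside n p q a)) (not (inside n p q b))

  reflect-swap : ∀ {Q} → SwapInvariant Q → SwapInvariant (Q ∘ reflect)
  reflect-swap Q-inv a b = Q-inv (ρ a) (ρ b)

  one-outer-swap : (F : ℕ → Bool) → SwapInvariant (λ e → one e ∧ F (outer e))
  one-outer-swap F a b with inside n p q a | inside n p q b
  ... | true  | true  = refl
  ... | true  | false = refl
  ... | false | true  = refl
  ... | false | false = refl

  one-inner-swap : (F : ℕ → Bool) → SwapInvariant (λ e → one e ∧ F (inner e))
  one-inner-swap F a b with inside n p q a | inside n p q b
  ... | true  | true  = refl
  ... | true  | false = refl
  ... | false | true  = refl
  ... | false | false = refl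

  count-partition : ∀ Q xs → count Q xs ≡
                    count (λ e → both e ∧ Q e) xs + (count (λ e → neither e ∧ Q e) xs + count (λ e → one e ∧ Q e) xs)
  count-partition Q xs = trans (count-split both Q xs) (cong (count (λ e → both e ∧ Q e) xs +_)
    (trans (count-split neither (λ e → not (both e) ∧ Q e) xs) (cong₂ _+_
      (count-cong xs (λ e _ → neither-case e)) (count-cong xs (λ e _ → one-case e)))))
    where
    neither-case : ∀ e → neither e ∧ (not (both e) ∧ Q e) ≡ neither e ∧ Q e
    neither-case (a , b) with inside n p q a | inside n p q b
    ... | true  | true  = refl
    ... | true  | false = refl
    ... | false | true  = refl
    ... | false | false = refl
    one-case : ∀ e → not (neither e) ∧ (not (both e) ∧ Q e) ≡ one e ∧ Q e
    one-case (a , b) with inside n p q a | inside n p q b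
    ... | true  | true  = refl
    ... | true  | false = refl
    ... | false | true  = refl
    ... | false | false = refl

  orient≡id⊎swap : ∀ e → one e ≡ true → orient e ≡ e ⊎ orient e ≡ swap e
  orient≡id⊎swap (a , b) _  with inside n p q a | inside n p q b
  orient≡id⊎swap (a , b) () | true  | true
  ... | true  | false = inj₂ refl
  ... | false | true  = inj₁ refl
  orient≡id⊎swap (a , b) () | false | false

  orient-ends : ∀ e → one e ≡ true → proj₁ e ≤ n → proj₂ e ≤ n → Outside (outer e) × Inside (inner e)
  orient-ends (a , b) _  _   _   with inside n p q a in ea | inside n p q b in eb
  orient-ends (a , b) () _   _   | true  | true
  orient-ends (a , b) _  _   b≤n | true  | false = inside≡false⇒ b≤n eb , inside≡true⇒ ea
  orient-ends (a , b) _  a≤n _   | false | true  = inside≡false⇒ a≤n ea , inside≡true⇒ eb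
  orient-ends (a , b) () _   _   | false | false

  orient-swapInvariant : ∀ {Q} → SwapInvariant Q → ∀ e → one e ≡ true → Q (orient e) ≡ Q e
  orient-swapInvariant {Q} Q-inv e@(a , b) one-e with orient≡id⊎swap e one-e
  ... | inj₁ eq = cong Q eq
  ... | inj₂ eq = trans (cong Q eq) (Q-inv b a)

  Separates-orientˡ : ∀ {e f} → one e ≡ true → Separates (orient e) f → Separates e f
  Separates-orientˡ {e@(_ , _)} one-e s with orient≡id⊎swap e one-e
  ... | inj₁ eq = subst (λ g → Separates g _) eq s
  ... | inj₂ eq = Separates-swapˡ (subst (λ g → Separates g _) eq s)

  Separates-orientʳ : ∀ {e f} → one f ≡ true → Separates e (orient f) → Separates e f
  Separates-orientʳ {f = f@(_ , _)} one-f s with orient≡id⊎swap f one-f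
  ... | inj₁ eq = subst (Separates _) eq s
  ... | inj₂ eq = Separates-swapʳ (subst (Separates _) eq s)

  categories : ∀ {g a b} → inside n p q (proj₁ g) ≡ a × inside n p q (proj₂ g) ≡ b →
               both g ≡ a ∧ b × neither g ≡ not a ∧ not b × one g ≡ not (a ∧ b) ∧ not (not a ∧ not b)
  categories (refl , refl) = refl , refl , refl

-- The action of one generator

record Valid (n : ℕ) (x : Diagram) : Set where
  field
    lab-injective : ∀ {i j} → i ≤ n → j ≤ n → lab x i ≡ lab x j → i ≡ j
    lab-≤         : ∀ {i} → i ≤ n → lab x i ≤ n
    arc-≤         : ∀ {e} → e ∈ arcs x → proj₁ e ≤ n × proj₂ e ≤ n
    arc-proper    : ∀ {e} → e ∈ arcs x → proj₁ e ≢ proj₂ e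
    noncrossing   : ∀ {e f} → e ∈ arcs x → f ∈ arcs x → ¬ Cross e f

IsArcDiagram⇒Valid : ∀ {n l x} → IsArcDiagram n l x → Valid n x
IsArcDiagram⇒Valid {n} {l} {x} isArc = record
  { lab-injective = λ {i} {j} → lab-inj i j
  ; lab-≤         = lab-≤
  ; arc-≤         = arc-range
  ; arc-proper    = arc-proper
  ; noncrossing   = noncross
  }
  where
  open IsArcDiagram isArc
  lab-≤ : ∀ {i} → i ≤ n → lab x i ≤ n
  lab-≤ {zero}  _   rewrite lab-∞ = z≤n
  lab-≤ {suc i} i≤n = proj₂ (lab-range (suc i) (s≤s z≤n) i≤n)

module Step (n p q : ℕ) (p≤q : p ≤ q) (q≤n : q ≤ n) (x : Diagram) (valid : Valid n x) where
  open Chord n p q p≤q q≤n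
  open Valid valid

  innerArcs outerArcs crossing : List Arc
  innerArcs = filterᵇ both (arcs x)
  outerArcs = filterᵇ neither (arcs x)
  crossing  = filterᵇ one (arcs x)

  reflectedArcs : List Arc
  reflectedArcs = map reflect innerArcs

  outerEnds reflectedInnerEnds : List ℕ
  outerEnds          = map outer crossing
  reflectedInnerEnds = map (ρ ∘ inner) crossing

  sortedOuterEnds sortedInnerEnds : List ℕ
  sortedOuterEnds = reverse (sortBy κ outerEnds)
  sortedInnerEnds = sortBy id reflectedInnerEnds

  rejoined : List Arc
  rejoined = zip sortedOuterEnds sortedInnerEnds

  x′ : Diagram
  x′ = actGen n p q x

  crossing-∈ : ∀ {e} → e ∈ crossing → e ∈ arcs x × one e ≡ true
  crossing-∈ = ∈-filterᵇ⁻ one {arcs x}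

  crossing-ends : ∀ {e} → e ∈ crossing → Outside (outer e) × Inside (inner e)
  crossing-ends {e} e∈ = let e∈x , one-e = crossing-∈ e∈ ; e₁≤n , e₂≤n = arc-≤ e∈x in
    orient-ends e one-e e₁≤n e₂≤n

  sortedOuterEnds-↭ : sortedOuterEnds ↭ outerEnds
  sortedOuterEnds-↭ = ↭-trans (↭.↭-reverse _) (sortBy-↭ κ outerEnds)

  sortedInnerEnds-↭ : sortedInnerEnds ↭ reflectedInnerEnds
  sortedInnerEnds-↭ = sortBy-↭ id reflectedInnerEnds

  rejoined-∈ : ∀ {g} → g ∈ rejoined →
               (∃ λ e → e ∈ crossing × proj₁ g ≡ outer e) × (∃ λ e → e ∈ crossing × proj₂ g ≡ ρ (inner e))
  rejoined-∈ g∈ = let o∈ , i∈ = ∈-zip⁻ g∈ in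
    ∈-map⁻ outer (↭.∈-resp-↭ sortedOuterEnds-↭ o∈) , ∈-map⁻ (ρ ∘ inner) (↭.∈-resp-↭ sortedInnerEnds-↭ i∈)

  rejoined-ends : ∀ {g} → g ∈ rejoined → Outside (proj₁ g) × Inside (proj₂ g)
  rejoined-ends g∈ with rejoined-∈ g∈
  ... | (e , e∈ , g₁≡) , (e′ , e′∈ , g₂≡) =
    subst Outside (sym g₁≡) (proj₁ (crossing-ends e∈)) , subst Inside (sym g₂≡) (Inside-ρ (proj₂ (crossing-ends e′∈)))

  rejoined-antitone : Antitone (κ ∘ proj₁) proj₂ rejoined
  rejoined-antitone g∈ h∈ g₂<h₂ with AllPairs-∈ (AllPairs-zip (AllPairs-reverse (sortBy-ascending κ outerEnds))
                                                                (sortBy-ascending id reflectedInnerEnds)) g∈ h∈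
  ... | inj₁ refl                = contradiction g₂<h₂ (<-irrefl refl)
  ... | inj₂ (inj₁ (κh≤κg , _)) = κh≤κg
  ... | inj₂ (inj₂ (_ , h₂≤g₂)) = contradiction g₂<h₂ (≤⇒≯ h₂≤g₂)

  private
    equal-lengths : length sortedOuterEnds ≡ length sortedInnerEnds
    equal-lengths = trans (↭.↭-length sortedOuterEnds-↭) (trans (length-map outer crossing)
                      (sym (trans (↭.↭-length sortedInnerEnds-↭) (length-map (ρ ∘ inner) crossing))))

  rejoined-outer-marginal : ∀ F → count (F ∘ proj₁) rejoined ≡ count (F ∘ outer) crossing
  rejoined-outer-marginal F = trans (count-zip₁ F sortedOuterEnds sortedInnerEnds equal-lengths)
    (trans (count-↭ F sortedOuterEnds-↭) (count-map F outer crossing))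

  rejoined-inner-marginal : ∀ F → count (F ∘ proj₂) rejoined ≡ count (F ∘ ρ ∘ inner) crossing
  rejoined-inner-marginal F = trans (count-zip₂ F sortedOuterEnds sortedInnerEnds equal-lengths)
    (trans (count-↭ F sortedInnerEnds-↭) (count-map F (ρ ∘ inner) crossing))

  crossing-antitone : Antitone (κ ∘ outer) inner crossing
  crossing-antitone {e} {f} e∈ f∈ e₂<f₂ = ≮⇒≥ λ κe<κf →
    let e∈x , one-e = crossing-∈ e∈ ; f∈x , one-f = crossing-∈ f∈
        oute , ine = crossing-ends e∈ ; outf , inf = crossing-ends f∈ in
    noncrossing e∈x f∈x (Separates⇒Cross e f (Separates-orientˡ one-e (Separates-orientʳ one-f
      (discordant⇒Separates oute outf ine inf e₂<f₂ κe<κf))))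

  crossing-fibres : ∀ {Q} → SwapInvariant Q → ConstantOnFibres _≟²_ (< κ ∘ outer , inner >) Q crossing
  crossing-fibres {Q} Q-inv {e} {f} e∈ f∈ eq with ,-injective eq
  ... | κe≡κf , inner≡ = begin
    Q e          ≡⟨ orient-swapInvariant Q-inv e (proj₂ (crossing-∈ e∈)) ⟨
    Q (orient e) ≡⟨ cong Q (cong₂ _,_ (κ-injective (proj₁ (crossing-ends e∈)) (proj₁ (crossing-ends f∈)) κe≡κf) inner≡) ⟩
    Q (orient f) ≡⟨ orient-swapInvariant Q-inv f (proj₂ (crossing-∈ f∈)) ⟩
    Q f          ∎
    where open ≡-Reasoning

  rejoined-fibres : ∀ Q → ConstantOnFibres _≟²_ (< κ ∘ proj₁ , proj₂ >) Q rejoined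
  rejoined-fibres Q g∈ h∈ eq with ,-injective eq
  ... | κg≡κh , g₂≡h₂ =
    cong Q (cong₂ _,_ (κ-injective (proj₁ (rejoined-ends g∈)) (proj₁ (rejoined-ends h∈)) κg≡κh) g₂≡h₂)

  private
    both-ends : ∀ e → both e ≡ true → inside n p q (proj₁ e) ≡ true × inside n p q (proj₂ e) ≡ true
    both-ends (a , b) h with inside n p q a | inside n p q b
    both-ends (a , b) h  | true  | true  = refl , refl
    both-ends (a , b) () | true  | false
    both-ends (a , b) () | false | _

    neither-ends : ∀ e → neither e ≡ true → inside n p q (proj₁ e) ≡ false × inside n p q (proj₂ e) ≡ false
    neither-ends (a , b) h with inside n p q a | inside n p q b
    neither-ends (a , b) h  | false | false = refl , refl
    neither-ends (a , b) () | false | true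
    neither-ends (a , b) () | true  | _

  innerArcs-Inside : ∀ {a} → a ∈ innerArcs → Inside (proj₁ a) × Inside (proj₂ a)
  innerArcs-Inside {a} a∈ = let in₁ , in₂ = both-ends a (proj₂ (∈-filterᵇ⁻ both {arcs x} a∈)) in
    inside≡true⇒ in₁ , inside≡true⇒ in₂

  outerArcs-outside : ∀ {c} → c ∈ outerArcs → inside n p q (proj₁ c) ≡ false × inside n p q (proj₂ c) ≡ false
  outerArcs-outside {c} c∈ = neither-ends c (proj₂ (∈-filterᵇ⁻ neither {arcs x} c∈))

  reflectedArcs-∈ : ∀ {g} → g ∈ reflectedArcs → ∃ λ a → a ∈ innerArcs × g ≡ reflect a
  reflectedArcs-∈ = ∈-map⁻ reflect

  reflectedArcs-Inside : ∀ {g} → g ∈ reflectedArcs → Inside (proj₁ g) × Inside (proj₂ g)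
  reflectedArcs-Inside g∈ with reflectedArcs-∈ g∈
  ... | a , a∈ , refl = let in₁ , in₂ = innerArcs-Inside a∈ in Inside-ρ in₁ , Inside-ρ in₂

  reflectedArcs-Between : ∀ {g y} → g ∈ reflectedArcs → Between (proj₁ g) (proj₂ g) y → Inside y
  reflectedArcs-Between g∈ = let in₁ , in₂ = reflectedArcs-Inside g∈ in Between-Inside in₁ in₂

  private
    count-pieces : ∀ (P Q : Arc → Bool) {b₁ b₂ b₃} → (∀ {g} → g ∈ reflectedArcs → P g ≡ b₁) →
                   (∀ {g} → g ∈ outerArcs → P g ≡ b₂) → (∀ {g} → g ∈ rejoined → P g ≡ b₃) →
                   count (λ g → P g ∧ Q g) (arcs x′) ≡
                   count (λ g → b₁ ∧ Q g) reflectedArcs +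
                   (count (λ g → b₂ ∧ Q g) outerArcs + count (λ g → b₃ ∧ Q g) rejoined)
    count-pieces P Q P₁ P₂ P₃ =
      trans (count-++ PQ reflectedArcs (outerArcs ++ rejoined)) (cong₂ _+_ (piece reflectedArcs P₁)
        (trans (count-++ PQ outerArcs rejoined) (cong₂ _+_ (piece outerArcs P₂) (piece rejoined P₃))))
      where
      PQ = λ g → P g ∧ Q g
      piece : ∀ {b} ys → (∀ {g} → g ∈ ys → P g ≡ b) → count PQ ys ≡ count (λ g → b ∧ Q g) ys
      piece ys Pb = count-cong ys (λ g g∈ → cong (_∧ Q g) (Pb g∈))

    reflectedArcs-sides : ∀ {g} → g ∈ reflectedArcs → inside n p q (proj₁ g) ≡ true × inside n p q (proj₂ g) ≡ true
    reflectedArcs-sides g∈ = let in₁ , in₂ = reflectedArcs-Inside g∈ in Inside⇒inside≡true in₁ , Inside⇒inside≡true in₂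

    rejoined-sides : ∀ {g} → g ∈ rejoined → inside n p q (proj₁ g) ≡ false × inside n p q (proj₂ g) ≡ true
    rejoined-sides g∈ = let out , ins = rejoined-ends g∈ in Outside⇒inside≡false out , Inside⇒inside≡true ins

  count-both-x′ : ∀ Q → count (λ g → both g ∧ Q g) (arcs x′) ≡ count Q reflectedArcs
  count-both-x′ Q = trans (count-pieces both Q (proj₁ ∘ categories ∘ reflectedArcs-sides)
    (proj₁ ∘ categories ∘ outerArcs-outside) (proj₁ ∘ categories ∘ rejoined-sides))
    (trans (cong (count Q reflectedArcs +_) (cong₂ _+_ (count-false outerArcs) (count-false rejoined))) (+-identityʳ _))

  count-neither-x′ : ∀ Q → count (λ g → neither g ∧ Q g) (arcs x′) ≡ count Q outerArcs
  count-neither-x′ Q = trans (count-pieces neither Q (proj₁ ∘ proj₂ ∘ categories ∘ reflectedArcs-sides)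
    (proj₁ ∘ proj₂ ∘ categories ∘ outerArcs-outside) (proj₁ ∘ proj₂ ∘ categories ∘ rejoined-sides))
    (trans (cong₂ _+_ (count-false reflectedArcs) (cong (count Q outerArcs +_) (count-false rejoined))) (+-identityʳ _))

  count-one-x′ : ∀ Q → count (λ g → one g ∧ Q g) (arcs x′) ≡ count Q rejoined
  count-one-x′ Q = trans (count-pieces one Q (proj₂ ∘ proj₂ ∘ categories ∘ reflectedArcs-sides)
    (proj₂ ∘ proj₂ ∘ categories ∘ outerArcs-outside) (proj₂ ∘ proj₂ ∘ categories ∘ rejoined-sides))
    (cong₂ _+_ (count-false reflectedArcs) (cong (_+ count Q rejoined) (count-false outerArcs)))

  private
    outer-rejoined : ∀ {g} → g ∈ rejoined → outer g ≡ proj₁ g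
    outer-rejoined {g} g∈ rewrite proj₁ (rejoined-sides g∈) = refl

    inner-rejoined : ∀ {g} → g ∈ rejoined → inner g ≡ proj₂ g
    inner-rejoined {g} g∈ rewrite proj₁ (rejoined-sides g∈) = refl

  crossing-outer-marginal : ∀ F → count (F ∘ outer) crossing ≡ count (λ g → one g ∧ F (outer g)) (arcs x′)
  crossing-outer-marginal F = begin
    count (F ∘ outer) crossing                  ≡⟨ rejoined-outer-marginal F ⟨
    count (F ∘ proj₁) rejoined                  ≡⟨ count-cong rejoined (λ g g∈ → cong F (outer-rejoined g∈)) ⟨
    count (F ∘ outer) rejoined                  ≡⟨ count-one-x′ (F ∘ outer) ⟨
    count (λ g → one g ∧ F (outer g)) (arcs x′) ∎
    where open ≡-Reasoning

  crossing-inner-marginal : ∀ F → count (F ∘ inner) crossing ≡ count (λ g → one g ∧ F (ρ (inner g))) (arcs x′)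
  crossing-inner-marginal F = begin
    count (F ∘ inner) crossing                      ≡⟨ count-cong crossing (λ e _ → cong F (ρ-involutive (inner e))) ⟨
    count (F ∘ ρ ∘ ρ ∘ inner) crossing              ≡⟨ rejoined-inner-marginal (F ∘ ρ) ⟨
    count (F ∘ ρ ∘ proj₂) rejoined                  ≡⟨ count-cong rejoined (λ g g∈ → cong (F ∘ ρ) (inner-rejoined g∈)) ⟨
    count (F ∘ ρ ∘ inner) rejoined                  ≡⟨ count-one-x′ (F ∘ ρ ∘ inner) ⟨
    count (λ g → one g ∧ F (ρ (inner g))) (arcs x′) ∎
    where open ≡-Reasoning

  module _ {d : ℕ} where

    CountsDivisible-x⇒x′ : CountsDivisible d (arcs x) → CountsDivisible d (arcs x′)
    CountsDivisible-x⇒x′ ∣x Q Q-inv =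
      subst (d ∣_) (sym split) (∣m∣n⇒∣m+n ∣reflected (∣m∣n⇒∣m+n ∣outer ∣rejoined))
      where
      split : count Q (arcs x′) ≡ count Q reflectedArcs + (count Q outerArcs + count Q rejoined)
      split = trans (count-++ Q reflectedArcs _) (cong (count Q reflectedArcs +_) (count-++ Q outerArcs rejoined))

      ∣reflected : d ∣ count Q reflectedArcs
      ∣reflected = subst (d ∣_) (sym (trans (count-map Q reflect innerArcs) (count-filterᵇ (Q ∘ reflect) both (arcs x))))
        (∣x _ (∧-SwapInvariant both-swap (reflect-swap Q-inv)))

      ∣outer : d ∣ count Q outerArcs
      ∣outer = subst (d ∣_) (sym (count-filterᵇ Q neither (arcs x))) (∣x _ (∧-SwapInvariant neither-swap Q-inv))

      ∣rejoined : d ∣ count Q rejoined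
      ∣rejoined = antitone-marginals⇒count-∣ (κ ∘ proj₁) proj₂ rejoined-antitone
        (λ R → subst (d ∣_) (sym (trans (rejoined-outer-marginal (R ∘ κ)) (count-filterᵇ (R ∘ κ ∘ outer) one (arcs x))))
                 (∣x _ (one-outer-swap (R ∘ κ))))
        (λ R → subst (d ∣_) (sym (trans (rejoined-inner-marginal R) (count-filterᵇ (R ∘ ρ ∘ inner) one (arcs x))))
                 (∣x _ (one-inner-swap (R ∘ ρ))))
        Q (rejoined-fibres Q)

    CountsDivisible-x′⇒x : CountsDivisible d (arcs x′) → CountsDivisible d (arcs x)
    CountsDivisible-x′⇒x ∣x′ Q Q-inv =
      subst (d ∣_) (sym (count-partition Q (arcs x))) (∣m∣n⇒∣m+n ∣inner (∣m∣n⇒∣m+n ∣outer ∣crossing))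
      where
      ∣inner : d ∣ count (λ e → both e ∧ Q e) (arcs x)
      ∣inner = subst (d ∣_) eq (∣x′ _ (∧-SwapInvariant both-swap (reflect-swap Q-inv)))
        where
        eq : count (λ g → both g ∧ Q (reflect g)) (arcs x′) ≡ count (λ e → both e ∧ Q e) (arcs x)
        eq = begin
          count (λ g → both g ∧ Q (reflect g)) (arcs x′) ≡⟨ count-both-x′ (Q ∘ reflect) ⟩
          count (Q ∘ reflect) reflectedArcs             ≡⟨ count-map (Q ∘ reflect) reflect innerArcs ⟩
          count (Q ∘ reflect ∘ reflect) innerArcs       ≡⟨ count-cong innerArcs (λ e _ → cong Q (reflect-involutive e)) ⟩
          count Q innerArcs                             ≡⟨ count-filterᵇ Q both (arcs x) ⟩
          count (λ e → both e ∧ Q e) (arcs x)           ∎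
          where open ≡-Reasoning

      ∣outer : d ∣ count (λ e → neither e ∧ Q e) (arcs x)
      ∣outer = subst (d ∣_) (trans (count-neither-x′ Q) (count-filterᵇ Q neither (arcs x)))
        (∣x′ _ (∧-SwapInvariant neither-swap Q-inv))

      ∣crossing : d ∣ count (λ e → one e ∧ Q e) (arcs x)
      ∣crossing = subst (d ∣_) (count-filterᵇ Q one (arcs x)) (antitone-marginals⇒count-∣ (κ ∘ outer) inner crossing-antitone
        (λ R → subst (d ∣_) (sym (crossing-outer-marginal (R ∘ κ))) (∣x′ _ (one-outer-swap (R ∘ κ))))
        (λ R → subst (d ∣_) (sym (crossing-inner-marginal R)) (∣x′ _ (one-inner-swap (R ∘ ρ))))
        Q (crossing-fibres Q-inv))

  private
    arcs-x′-∈ : ∀ {g} → g ∈ arcs x′ → g ∈ reflectedArcs ⊎ g ∈ outerArcs ⊎ g ∈ rejoined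
    arcs-x′-∈ g∈ with ∈-++⁻ reflectedArcs g∈
    ... | inj₁ g∈r = inj₁ g∈r
    ... | inj₂ g∈s = inj₂ (∈-++⁻ outerArcs g∈s)

    innerArcs⊆ : ∀ {a} → a ∈ innerArcs → a ∈ arcs x
    innerArcs⊆ a∈ = proj₁ (∈-filterᵇ⁻ both {arcs x} a∈)

    outerArcs⊆ : ∀ {c} → c ∈ outerArcs → c ∈ arcs x
    outerArcs⊆ c∈ = proj₁ (∈-filterᵇ⁻ neither {arcs x} c∈)

    outerArcs-Outside : ∀ {c} → c ∈ outerArcs → Outside (proj₁ c) × Outside (proj₂ c)
    outerArcs-Outside c∈ = let c₁≤n , c₂≤n = arc-≤ (outerArcs⊆ c∈) ; out₁ , out₂ = outerArcs-outside c∈ in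
      inside≡false⇒ c₁≤n out₁ , inside≡false⇒ c₂≤n out₂

    Inside≢Outside : ∀ {i o} → Inside i → Outside o → i ≢ o
    Inside≢Outside ins out refl with trans (sym (Inside⇒inside≡true ins)) (Outside⇒inside≡false out)
    ... | ()

    noncrossing-reflected-reflected : ∀ {g h} → g ∈ reflectedArcs → h ∈ reflectedArcs → ¬ Cross g h
    noncrossing-reflected-reflected g∈ h∈ c with reflectedArcs-∈ g∈ | reflectedArcs-∈ h∈
    ... | a , a∈ , refl | b , b∈ , refl =
      let ina₁ , ina₂ = innerArcs-Inside a∈ ; inb₁ , inb₂ = innerArcs-Inside b∈ in
      noncrossing (innerArcs⊆ a∈) (innerArcs⊆ b∈)
        (Separates⇒Cross a b (Separates-ρ⁻ ina₁ ina₂ inb₁ inb₂ (Cross⇒Separates (reflect a) (reflect b) c)))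

    noncrossing-reflected-outer : ∀ {g c} → g ∈ reflectedArcs → c ∈ outerArcs → ¬ Cross g c
    noncrossing-reflected-outer {g} {c} g∈ c∈ cr with Cross⇒Separates g c cr
    ... | inj₁ (between , _) = Inside≢Outside (reflectedArcs-Between g∈ between) (proj₁ (outerArcs-Outside c∈)) refl
    ... | inj₂ (_ , between) = Inside≢Outside (reflectedArcs-Between g∈ between) (proj₂ (outerArcs-Outside c∈)) refl

    crossing⊆ : ∀ {e} → e ∈ crossing → e ∈ arcs x
    crossing⊆ = proj₁ ∘ crossing-∈

    noncrossing-reflected-rejoined : ∀ {g h} → g ∈ reflectedArcs → h ∈ rejoined → ¬ Cross g h
    noncrossing-reflected-rejoined {g} {h} g∈ h∈ cr with reflectedArcs-∈ g∈ | Cross⇒Separates g h cr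
    ... | _ , _ , refl | inj₁ (between , _) =
      Inside≢Outside (reflectedArcs-Between g∈ between) (proj₁ (rejoined-ends h∈)) refl
    ... | a , a∈ , refl | inj₂ (_ , between) with proj₂ (rejoined-∈ h∈)
    ...   | e , e∈ , h₂≡ =
      let ina₁ , ina₂ = innerArcs-Inside a∈ ; oute , ine = crossing-ends e∈ in
      noncrossing (innerArcs⊆ a∈) (crossing⊆ e∈) (Separates⇒Cross a e (Separates-orientʳ (proj₂ (crossing-∈ e∈))
        (inj₂ (Outside⇒Beyond ina₁ ina₂ oute , Between-ρ⁻ ina₁ ina₂ ine (subst (Between _ _) h₂≡ between)))))

    noncrossing-outer-rejoined : ∀ {c h} → c ∈ outerArcs → h ∈ rejoined → ¬ Cross c h
    noncrossing-outer-rejoined {c} {h@(h₁ , h₂)} c∈ h∈ cr with proj₁ (rejoined-∈ h∈)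
    ... | e , e∈ , refl =
      let outc₁ , outc₂ = outerArcs-Outside c∈ in
      noncrossing (outerArcs⊆ c∈) (crossing⊆ e∈) (Separates⇒Cross c e (Separates-orientʳ (proj₂ (crossing-∈ e∈))
        (Separates-move outc₁ outc₂ (proj₂ (rejoined-ends h∈)) (proj₂ (crossing-ends e∈)) (Cross⇒Separates c h cr))))

    noncrossing-rejoined-rejoined : ∀ {g h} → g ∈ rejoined → h ∈ rejoined → ¬ Cross g h
    noncrossing-rejoined-rejoined {g@(_ , _)} {h@(_ , _)} g∈ h∈ cr
      with Separates⇒discordant (proj₁ (rejoined-ends g∈)) (proj₁ (rejoined-ends h∈))
                                (proj₂ (rejoined-ends g∈)) (proj₂ (rejoined-ends h∈)) (Cross⇒Separates g h cr)
    ... | inj₁ (g₂<h₂ , κg<κh) = <⇒≱ κg<κh (rejoined-antitone g∈ h∈ g₂<h₂)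
    ... | inj₂ (h₂<g₂ , κh<κg) = <⇒≱ κh<κg (rejoined-antitone h∈ g∈ h₂<g₂)

  noncrossing′ : ∀ {g h} → g ∈ arcs x′ → h ∈ arcs x′ → ¬ Cross g h
  noncrossing′ {g} {h} g∈ h∈ with arcs-x′-∈ g∈ | arcs-x′-∈ h∈
  ... | inj₁ g∈r        | inj₁ h∈r        = noncrossing-reflected-reflected g∈r h∈r
  ... | inj₁ g∈r        | inj₂ (inj₁ h∈o) = noncrossing-reflected-outer g∈r h∈o
  ... | inj₁ g∈r        | inj₂ (inj₂ h∈z) = noncrossing-reflected-rejoined g∈r h∈z
  ... | inj₂ (inj₁ g∈o) | inj₁ h∈r        = noncrossing-reflected-outer h∈r g∈o ∘ Cross-sym g h
  ... | inj₂ (inj₁ g∈o) | inj₂ (inj₁ h∈o) = noncrossing (outerArcs⊆ g∈o) (outerArcs⊆ h∈o)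
  ... | inj₂ (inj₁ g∈o) | inj₂ (inj₂ h∈z) = noncrossing-outer-rejoined g∈o h∈z
  ... | inj₂ (inj₂ g∈z) | inj₁ h∈r        = noncrossing-reflected-rejoined h∈r g∈z ∘ Cross-sym g h
  ... | inj₂ (inj₂ g∈z) | inj₂ (inj₁ h∈o) = noncrossing-outer-rejoined h∈o g∈z ∘ Cross-sym g h
  ... | inj₂ (inj₂ g∈z) | inj₂ (inj₂ h∈z) = noncrossing-rejoined-rejoined g∈z h∈z

  arc-≤′ : ∀ {g} → g ∈ arcs x′ → proj₁ g ≤ n × proj₂ g ≤ n
  arc-≤′ g∈ with arcs-x′-∈ g∈
  ... | inj₁ g∈r with reflectedArcs-∈ g∈r
  ...   | a , a∈ , refl = let a₁≤n , a₂≤n = arc-≤ (innerArcs⊆ a∈) in ρ-≤ a₁≤n , ρ-≤ a₂≤n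
  arc-≤′ g∈ | inj₂ (inj₁ g∈o) = arc-≤ (outerArcs⊆ g∈o)
  arc-≤′ g∈ | inj₂ (inj₂ g∈z) = let out , ins = rejoined-ends g∈z in Outside⇒≤ out , Inside⇒≤ ins

  arc-proper′ : ∀ {g} → g ∈ arcs x′ → proj₁ g ≢ proj₂ g
  arc-proper′ g∈ with arcs-x′-∈ g∈
  ... | inj₁ g∈r with reflectedArcs-∈ g∈r
  ...   | a , a∈ , refl = arc-proper (innerArcs⊆ a∈) ∘ ρ-injective
  arc-proper′ g∈ | inj₂ (inj₁ g∈o) = arc-proper (outerArcs⊆ g∈o)
  arc-proper′ g∈ | inj₂ (inj₂ g∈z) = let out , ins = rejoined-ends g∈z in Inside≢Outside ins out ∘ sym

  valid′ : Valid n x′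
  valid′ = record
    { lab-injective = λ i≤n j≤n eq → ρ-injective (lab-injective (ρ-≤ i≤n) (ρ-≤ j≤n) eq)
    ; lab-≤         = λ i≤n → lab-≤ (ρ-≤ i≤n)
    ; arc-≤         = arc-≤′
    ; arc-proper    = arc-proper′
    ; noncrossing   = noncrossing′
    }

  CountsDivisible-x′⇔x : ∀ {d} → CountsDivisible d (arcs x′) ⇔ CountsDivisible d (arcs x)
  CountsDivisible-x′⇔x = mk⇔ CountsDivisible-x′⇒x CountsDivisible-x⇒x′

-- Divisors of G

∣foldr-gcd⇔All : ∀ {d} xs → d ∣ foldr gcd 0 xs ⇔ All (d ∣_) xs
∣foldr-gcd⇔All {d} xs = mk⇔ (to xs) (from xs)
  where
  to : ∀ xs → d ∣ foldr gcd 0 xs → All (d ∣_) xs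
  to []       _   = []
  to (x ∷ xs) ∣xs = ∣-trans ∣xs (gcd[m,n]∣m x _) ∷ to xs (∣-trans ∣xs (gcd[m,n]∣n x _))
  from : ∀ xs → All (d ∣_) xs → d ∣ foldr gcd 0 xs
  from []       []            = d ∣0
  from (x ∷ xs) (∣x ∷ ∣xs) = gcd-greatest ∣x (from xs ∣xs)

∣G⇔ : ∀ {n d} x → d ∣ G n x ⇔ (∀ {a b} → a < b → b ≤ n → d ∣ N x a b)
∣G⇔ {n} {d} x = ⇔.trans (∣foldr-gcd⇔All _) (mk⇔ to from)
  where
  pairs : List ℕ
  pairs = concatMap (λ a → map (N x a) (filterᵇ (a <ᵇ_) (upTo (suc n)))) (upTo (suc n))
  to : All (d ∣_) pairs → ∀ {a b} → a < b → b ≤ n → d ∣ N x a b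
  to ∣pairs {a} a<b b≤n = All.lookup ∣pairs (∈-concat⁺′
    (∈-map⁺ (N x a) (∈-filter⁺ (T? ∘ (a <ᵇ_)) (∈-upTo⁺ (s≤s b≤n)) (<⇒<ᵇ a<b)))
    (∈-map⁺ (λ a → map (N x a) (filterᵇ (a <ᵇ_) (upTo (suc n)))) (∈-upTo⁺ (s≤s (<⇒≤ (<-≤-trans a<b b≤n))))))
  from : (∀ {a b} → a < b → b ≤ n → d ∣ N x a b) → All (d ∣_) pairs
  from ∣N = All.tabulate member
    where
    member : ∀ {y} → y ∈ pairs → d ∣ y
    member y∈ with ∈-concat⁻′ (map (λ a → map (N x a) (filterᵇ (a <ᵇ_) (upTo (suc n)))) (upTo (suc n))) y∈
    ... | ys , y∈ys , ys∈ with ∈-map⁻ (λ a → map (N x a) (filterᵇ (a <ᵇ_) (upTo (suc n)))) ys∈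
    ... | a , _ , refl with ∈-map⁻ (N x a) y∈ys
    ... | b , b∈ , refl = let b∈upTo , a<ᵇb = ∈-filter⁻ (T? ∘ (a <ᵇ_)) b∈ in
      ∣N (<ᵇ⇒< a b a<ᵇb) (≤-pred (∈-upTo⁻ b∈upTo))

module Labels {n : ℕ} {x : Diagram} (valid : Valid n x) where
  open Valid valid

  labels : Arc → Arc
  labels e = lab x (proj₁ e) , lab x (proj₂ e)

  -- N x a b is count (sameLabels a b) (arcs x) by definition.
  sameLabels : ℕ → ℕ → Arc → Bool
  sameLabels a b e =
    ((lab x (proj₁ e) ≡ᵇ a) ∧ (lab x (proj₂ e) ≡ᵇ b)) ∨ ((lab x (proj₁ e) ≡ᵇ b) ∧ (lab x (proj₂ e) ≡ᵇ a))

  sameLabels-swap : ∀ a b → SwapInvariant (sameLabels a b)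
  sameLabels-swap a b c d = trans (∨-comm ((lc ≡ᵇ a) ∧ (ld ≡ᵇ b)) ((lc ≡ᵇ b) ∧ (ld ≡ᵇ a)))
                                   (cong₂ _∨_ (∧-comm (lc ≡ᵇ b) (ld ≡ᵇ a)) (∧-comm (lc ≡ᵇ a) (ld ≡ᵇ b)))
    where lc = lab x c ; ld = lab x d

  labels-injective : ∀ {e f} → proj₁ e ≤ n × proj₂ e ≤ n → proj₁ f ≤ n × proj₂ f ≤ n →
                     labels e ≡ labels f → e ≡ f
  labels-injective (e₁≤n , e₂≤n) (f₁≤n , f₂≤n) eq with ,-injective eq
  ... | eq₁ , eq₂ = cong₂ _,_ (lab-injective e₁≤n f₁≤n eq₁) (lab-injective e₂≤n f₂≤n eq₂)

  N-fibre : ∀ {a b} → a ≤ b → count (fibre _≟²_ (sort ∘ labels) (a , b)) (arcs x) ≡ N x a b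
  N-fibre {a} {b} a≤b = count-cong (arcs x) λ e _ → does-⇔ (sort≡⇔ a≤b) (sort (labels e) ≟² (a , b))
    ((lab x (proj₁ e) ≟ a ×-dec lab x (proj₂ e) ≟ b) ⊎-dec (lab x (proj₁ e) ≟ b ×-dec lab x (proj₂ e) ≟ a))

  CountsDivisible⇔ : ∀ {d} → CountsDivisible d (arcs x) ⇔ (∀ {a b} → a < b → b ≤ n → d ∣ N x a b)
  CountsDivisible⇔ {d} = mk⇔ (λ ∣x {a} {b} _ _ → ∣x (sameLabels a b) (sameLabels-swap a b)) from
    where
    from : (∀ {a b} → a < b → b ≤ n → d ∣ N x a b) → CountsDivisible d (arcs x)
    from ∣N Q Q-inv = fibres-∣⇒count-∣ _≟²_ (sort ∘ labels) (arcs x) fibres Q constant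
      where
      fibres : ∀ c → d ∣ count (fibre _≟²_ (sort ∘ labels) c) (arcs x)
      fibres (a , b) with any? (λ f → sort (labels f) ≟² (a , b)) (arcs x)
      ... | no none  =
        subst (d ∣_) (sym (count-none (λ f → sort (labels f) ≟² (a , b)) (arcs x) (λ f∈ → none ∘ lose f∈))) (d ∣0)
      ... | yes some = subst (d ∣_) (sym (N-fibre (<⇒≤ a<b))) (∣N a<b b≤n)
        where
        f = proj₁ (find some)
        f∈ = proj₁ (proj₂ (find some))
        sorted≡ : sort (labels f) ≡ (a , b)
        sorted≡ = proj₂ (proj₂ (find some))
        distinct : lab x (proj₁ f) ≢ lab x (proj₂ f)
        distinct eq = arc-proper f∈ (lab-injective (proj₁ (arc-≤ f∈)) (proj₂ (arc-≤ f∈)) eq)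
        a<b : a < b
        a<b = subst₂ _<_ (proj₁ (,-injective sorted≡)) (proj₂ (,-injective sorted≡)) (⊓<⊔ distinct)
        b≤n : b ≤ n
        b≤n = subst (_≤ n) (proj₂ (,-injective sorted≡))
                (⊔-lub (lab-≤ (proj₁ (arc-≤ f∈))) (lab-≤ (proj₂ (arc-≤ f∈))))
      constant : ConstantOnFibres _≟²_ (sort ∘ labels) Q (arcs x)
      constant {e} {f@(f₁ , f₂)} e∈ f∈ eq with sort-injective eq
      ... | inj₁ same    = cong Q (labels-injective (arc-≤ e∈) (arc-≤ f∈) same)
      ... | inj₂ swapped =
        let f₁≤n , f₂≤n = arc-≤ f∈ in trans (cong Q (labels-injective (arc-≤ e∈) (f₂≤n , f₁≤n) swapped)) (Q-inv f₂ f₁)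

act-Valid : ∀ {n x} (w : Word n) → Valid n x → Valid n (act n w x)
act-Valid [] valid = valid
act-Valid {n} {x} ((p , q , _ , p<q , q≤n) ∷ w) valid =
  Step.valid′ n p q (<⇒≤ p<q) q≤n (act n w x) (act-Valid w valid)

act-CountsDivisible : ∀ {n x d} (w : Word n) → Valid n x →
                      CountsDivisible d (arcs (act n w x)) ⇔ CountsDivisible d (arcs x)
act-CountsDivisible [] _ = ⇔.refl
act-CountsDivisible {n} {x} ((p , q , _ , p<q , q≤n) ∷ w) valid =
  ⇔.trans (Step.CountsDivisible-x′⇔x n p q (<⇒≤ p<q) q≤n (act n w x) (act-Valid w valid))
          (act-CountsDivisible w valid)

∣G⇔CountsDivisible : ∀ {n x d} → Valid n x → d ∣ G n x ⇔ CountsDivisible d (arcs x)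
∣G⇔CountsDivisible {x = x} valid = ⇔.trans (∣G⇔ x) (⇔.sym (Labels.CountsDivisible⇔ valid))

lemma4p2 : (n : ℕ) → 2 ≤ n → (l : Fin (suc n) → ℕ) → (x : Diagram) → IsArcDiagram n l x
    → (g : Word n) → G n (act n g x) ≡ G n x
lemma4p2 n _ l x isArc g = ∣-antisym (Equivalence.to (same (G n y)) ∣-refl) (Equivalence.from (same (G n x)) ∣-refl)
  where
  y = act n g x
  valid = IsArcDiagram⇒Valid isArc
  same : ∀ d → d ∣ G n y ⇔ d ∣ G n x
  same d = ⇔.trans (∣G⇔CountsDivisible (act-Valid g valid))
             (⇔.trans (act-CountsDivisible g valid) (⇔.sym (∣G⇔CountsDivisible valid)))
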